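{- Let $\lambda$ be the full $k\times(n-k)$ rectangle, i.e. $\lambda_1=\dots=\lambda_k=n-k$. Then $X_\lambda\cdot\mathbf 1$ is the (unique) element $C\in M$ such that $\overline{C}=C$ and $C-w_\lambda(\mathbf 1)\in\bigoplus_{\varepsilon\in E} v\mathbb Z[v]\,\varepsilon$ (the parabolic Kazhdan–Lusztig element $C^J_{w_\lambda}$), where here $w_\lambda(\mathbf 1)=(-,\dots,-,+,\dots,+)$ ($n-k$ minuses followed by $k$ pluses).
   Context: Fix integers $1\le k\le n-1$. Let $\mathcal H$ be the Hecke algebra of $S_n$ over $\mathbb Q(v)$: generated by $T_1,\dots,T_{n-1}$ with braid relations and $(T_i-v)(T_i+v^{ -1})=0$; its bar involution is the ring automorphism with $v\mapsto v^{ -1}$, $T_i\mapsto T_i^{ -1}$. Let $E$ be the set of sequences $\varepsilon\in\{+,-\}^n$ with exactly $k$ pluses; $S_n$ acts by permuting positions, $s_i=(i,i+1)$. Let $M=\bigoplus_{\varepsilon\in E}\mathbb Q(v)\varepsilon$ with $\mathcal H$-action: $T_i\varepsilon=s_i\varepsilon$ if $(\varepsilon_i,\varepsilon_{i+1})=(+,-)$; $T_i\varepsilon=-v^{ -1}\varepsilon$ if $(\varepsilon_i,\varepsilon_{i+1})\in\{(-,-),(+,+)\}$; $T_i\varepsilon=s_i\varepsilon+(v-v^{ -1})\varepsilon$ if $(\varepsilon_i,\varepsilon_{i+1})=(-,+)$. Let $\mathbf 1=(+,\dots,+,-,\dots,-)$ ($k$ pluses then $n-k$ minuses); bar involution on $M$: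 $\overline{h\cdot\mathbf 1}=\overline h\cdot\mathbf 1$. For a Young diagram $\lambda$ in the $k\times(n-k)$ rectangle with $\ell$ nonzero rows, boxes $(i,j)$, $1\le j\le\lambda_i$: $w_\lambda=P_\ell\cdots P_1$ with $P_i=s_{k+\lambda_i-i}s_{k+\lambda_i-i-1}\cdots s_{k+1-i}$; shifts $r_{ij}=\max(r_{i,j+1},r_{i+1,j})+1$ with $r_{ij}=0$ for $(i,j)\notin\lambda$; $[r]=(v^r-v^{ -r})/(v-v^{ -1})$; $X_\lambda=Y_\ell\cdots Y_1$ with $Y_i=\prod_{j=\lambda_i}^{1}\bigl(T_{k+j-i}-\tfrac{v^{r_{ij}}}{[r_{ij}]}\bigr)$, the product over $j$ taken in decreasing order $j=\lambda_i,\lambda_i-1,\dots,1$ from left to right. -}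

module Defs where

open import Data.Bool using (Bool; true; false; if_then_else_)
open import Data.Nat as ℕ using (ℕ; zero; suc; _∸_; _⊔_; _≤ᵇ_)
open import Data.Integer using (ℤ; +_)
open import Data.Rational as ℚ using (ℚ; 0ℚ; 1ℚ)
open import Data.List using (List; []; _∷_; _++_; map; concat; concatMap; reverse; replicate; length)
open import Data.Nat.ListAction using (sum)
open import Data.List.Properties using (≡-dec)
open import Data.Product using (_×_; _,_; ∃)
open import Relation.Binary.PropositionalEquality using (_≡_)
open import Relation.Nullary using (yes; no)
import Data.Bool.Properties as BoolP

-- Polynomials in v over ℚ: coefficient lists, index i = coefficient of v^i

Poly : Set
Poly = List ℚ

_+P_ : Poly → Poly → Poly
[] +P q = q
(a ∷ p) +P [] = a ∷ p
(a ∷ p) +P (b ∷ q) = (a ℚ.+ b) ∷ (p +P q)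

_*sP_ : ℚ → Poly → Poly
a *sP p = map (a ℚ.*_) p

_*P_ : Poly → Poly → Poly
[] *P q = []
(a ∷ p) *P q = (a *sP q) +P (0ℚ ∷ (p *P q))

coeffP : Poly → ℕ → ℚ
coeffP [] _ = 0ℚ
coeffP (a ∷ p) zero = a
coeffP (a ∷ p) (suc i) = coeffP p i

_≈P_ : Poly → Poly → Set
p ≈P q = ∀ i → coeffP p i ≡ coeffP q i

-- Q(v): fractions num/den of polynomials (all denominators used below are
-- nonzero), equality by cross multiplication.

record RF : Set where
  constructor _//_
  field
    num : Poly
    den : Poly
open RF public

_≈F_ : RF → RF → Set
x ≈F y = (num x *P den y) ≈P (num y *P den x)

constF : ℚ → RF
constF a = (a ∷ []) // (1ℚ ∷ [])

0F 1F : RF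
0F = constF 0ℚ
1F = constF 1ℚ

_+F_ : RF → RF → RF
(a // b) +F (c // d) = ((a *P d) +P (c *P b)) // (b *P d)

_*F_ : RF → RF → RF
(a // b) *F (c // d) = (a *P c) // (b *P d)

-F_ : RF → RF
-F (a // b) = map ℚ.-_ a // b

_-F_ : RF → RF → RF
x -F y = x +F (-F y)

-- field division (used only with nonzero divisors)
_/F_ : RF → RF → RF
(a // b) /F (c // d) = (a *P d) // (b *P c)

vF v⁻¹F : RF
vF = (0ℚ ∷ 1ℚ ∷ []) // (1ℚ ∷ [])
v⁻¹F = (1ℚ ∷ []) // (0ℚ ∷ 1ℚ ∷ [])

_^F_ : RF → ℕ → RF
x ^F zero = 1F
x ^F suc r = x *F (x ^F r)

qint : ℕ → RF
qint r = ((vF ^F r) -F (v⁻¹F ^F r)) /F (vF -F v⁻¹F)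

-- bar involution on Q(v): v ↦ v⁻¹.  For p/q with D = max lengths,
-- p(v⁻¹)/q(v⁻¹) = (v^{D-1} p(v⁻¹)) / (v^{D-1} q(v⁻¹)).
flipP : ℕ → Poly → Poly
flipP D p = reverse (p ++ replicate (D ∸ length p) 0ℚ)

barF : RF → RF
barF (a // b) = flipP (length a ⊔ length b) a // flipP (length a ⊔ length b) b

InVZv : RF → Set
InVZv x = ∃ λ (f : List ℤ) → x ≈F ((0ℚ ∷ map (λ z → z ℚ./ 1) f) // (1ℚ ∷ []))

-- The module M: sequences ε ∈ {+,-}^n as List Bool (true = +),
-- elements of M as finite formal Q(v)-combinations.

Seq : Set
Seq = List Bool

countPlus : Seq → ℕ
countPlus [] = 0
countPlus (true ∷ ε) = suc (countPlus ε)
countPlus (false ∷ ε) = countPlus ε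

InE : ℕ → ℕ → Seq → Set
InE n k ε = (length ε ≡ n) × (countPlus ε ≡ k)

M : Set
M = List (RF × Seq)

coeffM : M → Seq → RF
coeffM [] ε = 0F
coeffM ((c , δ) ∷ m) ε with ≡-dec BoolP._≟_ δ ε
... | yes _ = c +F coeffM m ε
... | no _ = coeffM m ε

_+M_ : M → M → M
m +M m' = m ++ m'

_*sM_ : RF → M → M
c *sM m = map (λ { (d , ε) → (c *F d , ε) }) m

_-M_ : M → M → M
m -M m' = m +M ((-F 1F) *sM m')

basis : Seq → M
basis ε = (1F , ε) ∷ []

-- action of T_i (1-based i) on a basis vector
Tbasis : ℕ → Seq → M
Tbasis (suc zero) (true ∷ false ∷ ε) = basis (false ∷ true ∷ ε)
Tbasis (suc zero) (false ∷ true ∷ ε) =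
  (1F , true ∷ false ∷ ε) ∷ ((vF -F v⁻¹F) , false ∷ true ∷ ε) ∷ []
Tbasis (suc zero) (true ∷ true ∷ ε) = ((-F v⁻¹F) , true ∷ true ∷ ε) ∷ []
Tbasis (suc zero) (false ∷ false ∷ ε) = ((-F v⁻¹F) , false ∷ false ∷ ε) ∷ []
Tbasis (suc (suc i)) (a ∷ ε) = map (λ { (c , δ) → (c , a ∷ δ) }) (Tbasis (suc i) ε)
Tbasis _ ε = basis ε   -- out of range; never used

actT : ℕ → M → M
actT i m = concatMap (λ { (c , ε) → c *sM Tbasis i ε }) m

data H : Set where
  T    : ℕ → H
  Tinv : ℕ → H
  sc   : RF → H
  _⊕_  : H → H → H
  _⊗_  : H → H → H

barH : H → H
barH (T i) = Tinv i
barH (Tinv i) = T i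
barH (sc c) = sc (barF c)
barH (h ⊕ h') = barH h ⊕ barH h'
barH (h ⊗ h') = barH h ⊗ barH h'

-- T_i⁻¹ = T_i - (v - v⁻¹) by the quadratic relation
actH : H → M → M
actH (T i) m = actT i m
actH (Tinv i) m = actT i m -M ((vF -F v⁻¹F) *sM m)
actH (sc c) m = c *sM m
actH (h ⊕ h') m = actH h m +M actH h' m
actH (h ⊗ h') m = actH h (actH h' m)

prodH : List H → H
prodH [] = sc 1F
prodH (h ∷ hs) = h ⊗ prodH hs

-- Young diagrams λ: list of rows λ₁ ≥ … ≥ λ_ℓ (1-based access, 0 beyond)

row : List ℕ → ℕ → ℕ
row [] _ = 0
row (a ∷ l) zero = 0
row (a ∷ l) (suc zero) = a
row (a ∷ l) (suc (suc i)) = row l (suc i)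

downFrom : ℕ → List ℕ
downFrom zero = []
downFrom (suc m) = suc m ∷ downFrom m

inBox : List ℕ → ℕ → ℕ → Bool
inBox lam zero j = false
inBox lam (suc i) zero = false
inBox lam (suc i) (suc j) = suc j ≤ᵇ row lam (suc i)

-- r_{ij} = max(r_{i,j+1}, r_{i+1,j}) + 1 on boxes, 0 outside; computed with
-- fuel (sum λ + 1 exceeds any path length, so the fuel never runs out on boxes)
rAux : List ℕ → ℕ → ℕ → ℕ → ℕ
rAux lam zero i j = 0
rAux lam (suc f) i j =
  if inBox lam i j then suc (rAux lam f i (suc j) ⊔ rAux lam f (suc i) j) else 0

shift : List ℕ → ℕ → ℕ → ℕ
shift lam i j = rAux lam (suc (sum lam)) i j

-- X_λ = Y_ℓ ⋯ Y_1,  Y_i = ∏_{j=λ_i}^{1} (T_{k+j-i} - v^{r_ij}/[r_ij])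
Yfac : ℕ → List ℕ → ℕ → ℕ → H
Yfac k lam i j = T ((k ℕ.+ j) ∸ i) ⊕ sc (-F ((vF ^F shift lam i j) /F qint (shift lam i j)))

Y : ℕ → List ℕ → ℕ → H
Y k lam i = prodH (map (Yfac k lam i) (downFrom (row lam i)))

X : ℕ → List ℕ → H
X k lam = prodH (map (Y k lam) (downFrom (length lam)))

-- w_λ = P_ℓ ⋯ P_1, P_i = s_{k+λ_i-i} ⋯ s_{k+1-i}, as a word of indices
P : ℕ → List ℕ → ℕ → List ℕ
P k lam i = map (λ t → (k ℕ.+ t) ∸ i) (downFrom (row lam i))

wword : ℕ → List ℕ → List ℕ
wword k lam = concat (map (P k lam) (downFrom (length lam)))

-- s_i swaps positions i, i+1 (1-based)
swap : ℕ → Seq → Seq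
swap (suc zero) (a ∷ b ∷ ε) = b ∷ a ∷ ε
swap (suc (suc i)) (a ∷ ε) = a ∷ swap (suc i) ε
swap _ ε = ε

-- action of a word s_{a₁} ⋯ s_{aₘ} (rightmost applied first)
wact : List ℕ → Seq → Seq
wact [] ε = ε
wact (s ∷ ss) ε = swap s (wact ss ε)

one : ℕ → ℕ → Seq
one n k = replicate k true ++ replicate (n ∸ k) false

rect : ℕ → ℕ → List ℕ
rect n k = replicate k (n ∸ k)

-- At v = q an element of M is represented by its coefficient function Seq → ℚ, on which T_i
-- acts by the transposed matrix.  Let C b c be the vector with coefficient
-- (-q)^(number of pairs + before -) at each word with b pluses and c minuses.  One row of X_λ
-- applied to + ⊗ C b c gives A · C b c ⊗ + + B · C (b+1) (c-1) ⊗ - for explicit scalars A, B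
-- (induction on the length of the row, looking at its last two letters); peeling off the row
-- applied first, induction on the number of rows gives X_λ·𝟏 = C k (n-k).  Its coefficient at
-- the sorted word w_λ(𝟏) is 1 and all others lie in vℤ[v].  Each factor T_i - v^r/[r] is bar
-- invariant since v^r/[r] - v^(-r)/[r] = v - v⁻¹ = T_i - T_i⁻¹, so bar(X_λ)·𝟏 = X_λ·𝟏.  All
-- identities in ℚ(v) are checked at v = 2, 3, 4, …: a polynomial vanishing at all of them is 0.

module Submission where

open import Level using (0ℓ)
open import Algebra using (CommutativeRing)
open import Data.Bool using (Bool; true; false; if_then_else_)
import Data.Bool.Properties as Bool
open import Data.Empty using (⊥-elim)
open import Data.Integer as ℤ using (ℤ)
open import Data.List using (List; []; _∷_; _++_; map; concat; reverse; replicate; length)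
import Data.List.Properties as List
open import Data.List.Relation.Unary.All using (All; []; _∷_)
import Data.List.Relation.Unary.All.Properties as All
open import Data.Maybe using (Maybe; just; nothing)
open import Data.Nat as ℕ using (ℕ; zero; suc; _∸_; _⊔_; _≤_; _<_; z≤n; s≤s; _≤ᵇ_)
import Data.Nat.Properties as ℕ
open import Data.Nat.ListAction using (sum)
open import Data.Product using (∃; _,_; _×_; proj₁; proj₂)
open import Data.Rational as ℚ using (ℚ; 0ℚ; 1ℚ; _+_; _*_; -_; _-_)
import Data.Rational.Properties as ℚ
open import Data.Sum using (inj₁; inj₂)
open import Data.Unit using (⊤; tt)
open import Function using (_∘_; Equivalence)
open import Relation.Binary.Definitions using (tri<; tri≈; tri>)
open import Relation.Binary.PropositionalEquality
open import Relation.Nullary using (yes; no; does)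
open import Tactic.RingSolver using (solve-∀)
import Tactic.RingSolver.Core.AlmostCommutativeRing as ACR

open import Defs

ℚ-ring : ACR.AlmostCommutativeRing 0ℓ 0ℓ
ℚ-ring = ACR.fromCommutativeRing ℚ.+-*-commutativeRing isZero
  where
  isZero : ∀ x → Maybe (0ℚ ≡ x)
  isZero x with 0ℚ ℚ.≟ x
  ... | yes 0≡x = just 0≡x
  ... | no _ = nothing

open import Algebra.Properties.CommutativeSemiring.Exp
  (CommutativeRing.commutativeSemiring ℚ.+-*-commutativeRing)
  using (_^_; ^-homo-*; ^-distrib-*)

inv : ℚ → ℚ
inv x with x ℚ.≟ 0ℚ
... | yes _ = 0ℚ
... | no x≢0 = ℚ.1/_ x {{ℚ.≢-nonZero x≢0}}

*-invʳ : ∀ {x} → x ≢ 0ℚ → x * inv x ≡ 1ℚ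
*-invʳ {x} x≢0 with x ℚ.≟ 0ℚ
... | yes x≡0 = ⊥-elim (x≢0 x≡0)
... | no x≢0′ = ℚ.*-inverseʳ x {{ℚ.≢-nonZero x≢0′}}

*-invˡ : ∀ {x} → x ≢ 0ℚ → inv x * x ≡ 1ℚ
*-invˡ {x} x≢0 = trans (ℚ.*-comm (inv x) x) (*-invʳ x≢0)

*-cancelˡ : ∀ {x a b} → x ≢ 0ℚ → x * a ≡ x * b → a ≡ b
*-cancelˡ {x} {a} {b} x≢0 eq = begin
  a                    ≡⟨ regroup a ⟨
  inv x * (x * a)      ≡⟨ cong (inv x *_) eq ⟩
  inv x * (x * b)      ≡⟨ regroup b ⟩
  b                    ∎
  where
  open ≡-Reasoning
  regroup : ∀ y → inv x * (x * y) ≡ y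
  regroup y = begin
    inv x * (x * y)    ≡⟨ ℚ.*-assoc (inv x) x y ⟨
    (inv x * x) * y    ≡⟨ cong (_* y) (*-invˡ x≢0) ⟩
    1ℚ * y             ≡⟨ ℚ.*-identityˡ y ⟩
    y                  ∎

*-cancelʳ : ∀ {x a b} → x ≢ 0ℚ → a * x ≡ b * x → a ≡ b
*-cancelʳ {x} {a} {b} x≢0 eq = *-cancelˡ x≢0 (trans (ℚ.*-comm x a) (trans eq (ℚ.*-comm b x)))

*-≢0 : ∀ {x y} → x ≢ 0ℚ → y ≢ 0ℚ → x * y ≢ 0ℚ
*-≢0 {x} x≢0 y≢0 xy≡0 = y≢0 (*-cancelˡ x≢0 (trans xy≡0 (sym (ℚ.*-zeroʳ x))))

^-≢0 : ∀ {x} n → x ≢ 0ℚ → x ^ n ≢ 0ℚ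
^-≢0 zero    _   = ℚ.1≢0
^-≢0 (suc n) x≢0 = *-≢0 x≢0 (^-≢0 n x≢0)

neg-≢0 : ∀ {x} → x ≢ 0ℚ → - x ≢ 0ℚ
neg-≢0 x≢0 -x≡0 = x≢0 (ℚ.neg-injective -x≡0)

1^n≡1 : ∀ n → 1ℚ ^ n ≡ 1ℚ
1^n≡1 zero    = refl
1^n≡1 (suc n) = trans (ℚ.*-identityˡ (1ℚ ^ n)) (1^n≡1 n)

inv-^ : ∀ {x} n → x ≢ 0ℚ → x ^ n * inv x ^ n ≡ 1ℚ
inv-^ {x} n x≢0 = begin
  x ^ n * inv x ^ n    ≡⟨ ^-distrib-* x (inv x) n ⟨
  (x * inv x) ^ n      ≡⟨ cong (_^ n) (*-invʳ x≢0) ⟩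
  1ℚ ^ n               ≡⟨ 1^n≡1 n ⟩
  1ℚ                   ∎
  where open ≡-Reasoning

x-y≡0⇒x≡y : ∀ {x y} → x - y ≡ 0ℚ → x ≡ y
x-y≡0⇒x≡y {x} {y} x-y≡0 = begin
  x              ≡⟨ ring x y ⟩
  (x - y) + y    ≡⟨ cong (_+ y) x-y≡0 ⟩
  0ℚ + y         ≡⟨ ℚ.+-identityˡ y ⟩
  y              ∎
  where
  open ≡-Reasoning
  ring : ∀ x y → x ≡ (x - y) + y
  ring = solve-∀ ℚ-ring

x∙yz≡y∙xz : ∀ x y z → x * (y * z) ≡ y * (x * z)
x∙yz≡y∙xz = solve-∀ ℚ-ring

a+d*0≡a : ∀ a d → a + d * 0ℚ ≡ a
a+d*0≡a a d = trans (cong (a +_) (ℚ.*-zeroʳ d)) (ℚ.+-identityʳ a)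

d*0≡0+e*0 : ∀ d e → d * 0ℚ ≡ 0ℚ + e * 0ℚ
d*0≡0+e*0 d e = trans (ℚ.*-zeroʳ d) (sym (a+d*0≡a 0ℚ e))

x+-1*y≡x-y : ∀ x y → x + - 1ℚ * y ≡ x - y
x+-1*y≡x-y = solve-∀ ℚ-ring

q*0-k*0≡0 : ∀ q k → q * 0ℚ - k * 0ℚ ≡ 0ℚ
q*0-k*0≡0 = solve-∀ ℚ-ring

e*-0-n*0≡0 : ∀ e n → e * (- 0ℚ) - n * 0ℚ ≡ 0ℚ
e*-0-n*0≡0 = solve-∀ ℚ-ring

e*[a*0]≡0 : ∀ e a → e * (a * 0ℚ) ≡ 0ℚ
e*[a*0]≡0 = solve-∀ ℚ-ring

e*[0*a]≡0 : ∀ e a → e * (0ℚ * a) ≡ 0ℚ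
e*[0*a]≡0 = solve-∀ ℚ-ring

e*-[s*0]-n*[s*0]≡0 : ∀ e n s → e * (- (s * 0ℚ)) - n * (s * 0ℚ) ≡ 0ℚ
e*-[s*0]-n*[s*0]≡0 = solve-∀ ℚ-ring

e*[q*0]-n*0≡0 : ∀ e n q → e * (q * 0ℚ) - n * 0ℚ ≡ 0ℚ
e*[q*0]-n*0≡0 = solve-∀ ℚ-ring

e*[q*0+d*0]-n*0≡0 : ∀ e n q d → e * (q * 0ℚ + d * 0ℚ) - n * 0ℚ ≡ 0ℚ
e*[q*0+d*0]-n*0≡0 = solve-∀ ℚ-ring

ι : ℕ → ℚ
ι zero    = 0ℚ
ι (suc n) = 1ℚ + ι n

ι-+ : ∀ a b → ι (a ℕ.+ b) ≡ ι a + ι b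
ι-+ zero    b = sym (ℚ.+-identityˡ (ι b))
ι-+ (suc a) b = trans (cong (1ℚ +_) (ι-+ a b)) (sym (ℚ.+-assoc 1ℚ (ι a) (ι b)))

ι-* : ∀ a b → ι (a ℕ.* b) ≡ ι a * ι b
ι-* zero    b = sym (ℚ.*-zeroˡ (ι b))
ι-* (suc a) b = begin
  ι (b ℕ.+ a ℕ.* b)        ≡⟨ ι-+ b (a ℕ.* b) ⟩
  ι b + ι (a ℕ.* b)        ≡⟨ cong (ι b +_) (ι-* a b) ⟩
  ι b + ι a * ι b          ≡⟨ ring (ι a) (ι b) ⟩
  (1ℚ + ι a) * ι b         ∎
  where
  open ≡-Reasoning
  ring : ∀ x y → y + x * y ≡ (1ℚ + x) * y
  ring = solve-∀ ℚ-ring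

ι-^ : ∀ a n → ι (a ℕ.^ n) ≡ ι a ^ n
ι-^ a zero    = refl
ι-^ a (suc n) = trans (ι-* a (a ℕ.^ n)) (cong (ι a *_) (ι-^ a n))

0<ι-suc : ∀ n → 0ℚ ℚ.< ι (suc n)
0<ι-suc zero    = ℚ.positive⁻¹ 1ℚ
0<ι-suc (suc n) = ℚ.+-mono-<-≤ (ℚ.positive⁻¹ 1ℚ) (ℚ.<⇒≤ (0<ι-suc n))

ι-strictlyIncreasing : ∀ {a b} → a < b → ι a ℚ.< ι b
ι-strictlyIncreasing {a} a<b with ℕ.m≤n⇒∃[o]m+o≡n a<b
... | d , refl = begin-strict
  ι a                  ≡⟨ ℚ.+-identityˡ (ι a) ⟨
  0ℚ + ι a             <⟨ ℚ.+-monoˡ-< (ι a) (0<ι-suc d) ⟩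
  ι (suc d) + ι a      ≡⟨ trans (ℚ.+-comm (ι (suc d)) (ι a)) (sym (ι-+ a (suc d))) ⟩
  ι (a ℕ.+ suc d)      ≡⟨ cong ι (ℕ.+-suc a d) ⟩
  ι (suc a ℕ.+ d)      ∎
  where open ℚ.≤-Reasoning

ι-injective : ∀ {a b} → ι a ≡ ι b → a ≡ b
ι-injective {a} {b} eq with ℕ.<-cmp a b
... | tri< a<b _ _ = ⊥-elim (ℚ.<⇒≢ (ι-strictlyIncreasing a<b) eq)
... | tri≈ _ a≡b _ = a≡b
... | tri> _ _ b<a = ⊥-elim (ℚ.<⇒≢ (ι-strictlyIncreasing b<a) (sym eq))

-- Polynomials and the identity principle

evalP : Poly → ℚ → ℚ
evalP []      x = 0ℚ
evalP (a ∷ p) x = a + x * evalP p x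

evalP-+P : ∀ p p' x → evalP (p +P p') x ≡ evalP p x + evalP p' x
evalP-+P []      p'       x = sym (ℚ.+-identityˡ (evalP p' x))
evalP-+P (a ∷ p) []       x = sym (ℚ.+-identityʳ (evalP (a ∷ p) x))
evalP-+P (a ∷ p) (b ∷ p') x =
  trans (cong (λ e → (a + b) + x * e) (evalP-+P p p' x)) (ring a b x (evalP p x) (evalP p' x))
  where
  ring : ∀ a b x u w → (a + b) + x * (u + w) ≡ (a + x * u) + (b + x * w)
  ring = solve-∀ ℚ-ring

evalP-*sP : ∀ a p x → evalP (a *sP p) x ≡ a * evalP p x
evalP-*sP a []      x = sym (ℚ.*-zeroʳ a)
evalP-*sP a (b ∷ p) x =
  trans (cong (λ e → a * b + x * e) (evalP-*sP a p x)) (ring a b x (evalP p x))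
  where
  ring : ∀ a b x u → a * b + x * (a * u) ≡ a * (b + x * u)
  ring = solve-∀ ℚ-ring

evalP-*P : ∀ p p' x → evalP (p *P p') x ≡ evalP p x * evalP p' x
evalP-*P []      p' x = sym (ℚ.*-zeroˡ (evalP p' x))
evalP-*P (a ∷ p) p' x = begin
  evalP ((a *sP p') +P (0ℚ ∷ (p *P p'))) x
    ≡⟨ evalP-+P (a *sP p') (0ℚ ∷ (p *P p')) x ⟩
  evalP (a *sP p') x + (0ℚ + x * evalP (p *P p') x)
    ≡⟨ cong₂ (λ u w → u + (0ℚ + x * w)) (evalP-*sP a p' x) (evalP-*P p p' x) ⟩
  a * evalP p' x + (0ℚ + x * (evalP p x * evalP p' x))
    ≡⟨ ring a x (evalP p x) (evalP p' x) ⟩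
  (a + x * evalP p x) * evalP p' x ∎
  where
  open ≡-Reasoning
  ring : ∀ a x u w → a * w + (0ℚ + x * (u * w)) ≡ (a + x * u) * w
  ring = solve-∀ ℚ-ring

evalP-neg : ∀ p x → evalP (map -_ p) x ≡ - evalP p x
evalP-neg []      x = refl
evalP-neg (a ∷ p) x = trans (cong (λ e → - a + x * e) (evalP-neg p x)) (ring a x (evalP p x))
  where
  ring : ∀ a x u → - a + x * (- u) ≡ - (a + x * u)
  ring = solve-∀ ℚ-ring

evalP-++ : ∀ p p' x → evalP (p ++ p') x ≡ evalP p x + x ^ length p * evalP p' x
evalP-++ []      p' x = sym (trans (ℚ.+-identityˡ _) (ℚ.*-identityˡ _))
evalP-++ (a ∷ p) p' x =
  trans (cong (λ e → a + x * e) (evalP-++ p p' x)) (ring a x (evalP p x) (x ^ length p) (evalP p' x))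
  where
  ring : ∀ a x u y w → a + x * (u + y * w) ≡ (a + x * u) + (x * y) * w
  ring = solve-∀ ℚ-ring

evalP-zeros : ∀ e x → evalP (replicate e 0ℚ) x ≡ 0ℚ
evalP-zeros zero    x = refl
evalP-zeros (suc e) x = trans (cong (λ u → 0ℚ + x * u) (evalP-zeros e x)) (cong (0ℚ +_) (ℚ.*-zeroʳ x))

evalP-++-zeros : ∀ p e x → evalP (p ++ replicate e 0ℚ) x ≡ evalP p x
evalP-++-zeros p e x = begin
  evalP (p ++ replicate e 0ℚ) x                          ≡⟨ evalP-++ p (replicate e 0ℚ) x ⟩
  evalP p x + x ^ length p * evalP (replicate e 0ℚ) x    ≡⟨ cong (λ u → evalP p x + x ^ length p * u) (evalP-zeros e x) ⟩
  evalP p x + x ^ length p * 0ℚ                          ≡⟨ a+d*0≡a (evalP p x) (x ^ length p) ⟩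
  evalP p x                                              ∎
  where open ≡-Reasoning

-- The reversed polynomial is v^(length p - 1) p(1/v); the shift by one
-- avoids a truncated subtraction.
evalP-reverse : ∀ p {x} → x ≢ 0ℚ → x * evalP (reverse p) x ≡ x ^ length p * evalP p (inv x)
evalP-reverse []      {x} _   = ℚ.*-zeroʳ x
evalP-reverse (a ∷ p) {x} x≢0 = begin
  x * evalP (reverse (a ∷ p)) x
    ≡⟨ cong (λ r → x * evalP r x) (List.unfold-reverse a p) ⟩
  x * evalP (reverse p ++ a ∷ []) x
    ≡⟨ cong (x *_) (evalP-++ (reverse p) (a ∷ []) x) ⟩
  x * (evalP (reverse p) x + x ^ length (reverse p) * (a + x * 0ℚ))
    ≡⟨ cong (λ n → x * (evalP (reverse p) x + x ^ n * (a + x * 0ℚ))) (List.length-reverse p) ⟩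
  x * (evalP (reverse p) x + y * (a + x * 0ℚ))
    ≡⟨ ring₁ x (evalP (reverse p) x) y a ⟩
  x * evalP (reverse p) x + (x * y) * a
    ≡⟨ cong (_+ (x * y) * a) (evalP-reverse p x≢0) ⟩
  y * evalP p (inv x) + (x * y) * a
    ≡⟨ cong (λ u → u * evalP p (inv x) + (x * y) * a) (ℚ.*-identityʳ y) ⟨
  y * 1ℚ * evalP p (inv x) + (x * y) * a
    ≡⟨ cong (λ u → y * u * evalP p (inv x) + (x * y) * a) (*-invʳ x≢0) ⟨
  y * (x * inv x) * evalP p (inv x) + (x * y) * a
    ≡⟨ ring₂ x y (inv x) (evalP p (inv x)) a ⟩
  (x * y) * (a + inv x * evalP p (inv x)) ∎
  where
  open ≡-Reasoning
  y = x ^ length p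
  ring₁ : ∀ x u y a → x * (u + y * (a + x * 0ℚ)) ≡ x * u + (x * y) * a
  ring₁ = solve-∀ ℚ-ring
  ring₂ : ∀ x y i e a → y * (x * i) * e + (x * y) * a ≡ (x * y) * (a + i * e)
  ring₂ = solve-∀ ℚ-ring

evalP-flipP : ∀ D p {z} → z ≢ 0ℚ → length p ≤ D → z * evalP (flipP D p) z ≡ z ^ D * evalP p (inv z)
evalP-flipP D p {z} z≢0 p≤D = begin
  z * evalP (reverse padded) z              ≡⟨ evalP-reverse padded z≢0 ⟩
  z ^ length padded * evalP padded (inv z)  ≡⟨ cong₂ (λ n e → z ^ n * e) length-padded (evalP-++-zeros p _ (inv z)) ⟩
  z ^ D * evalP p (inv z)                   ∎
  where
  open ≡-Reasoning
  padded = p ++ replicate (D ∸ length p) 0ℚ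
  length-padded : length padded ≡ D
  length-padded = trans (List.length-++ p)
    (trans (cong (length p ℕ.+_) (List.length-replicate (D ∸ length p))) (ℕ.m+[n∸m]≡n p≤D))

coeffP-+P : ∀ p p' i → coeffP (p +P p') i ≡ coeffP p i + coeffP p' i
coeffP-+P []      p'       i       = sym (ℚ.+-identityˡ (coeffP p' i))
coeffP-+P (a ∷ p) []       zero    = sym (ℚ.+-identityʳ a)
coeffP-+P (a ∷ p) []       (suc i) = sym (ℚ.+-identityʳ (coeffP p i))
coeffP-+P (a ∷ p) (b ∷ p') zero    = refl
coeffP-+P (a ∷ p) (b ∷ p') (suc i) = coeffP-+P p p' i

coeffP-neg : ∀ p i → coeffP (map -_ p) i ≡ - coeffP p i
coeffP-neg []      i       = refl
coeffP-neg (a ∷ p) zero    = refl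
coeffP-neg (a ∷ p) (suc i) = coeffP-neg p i

-- Synthetic division: p = (x - c) · divideBy c p + p(c).
divideBy : ℚ → Poly → Poly
divideBy c []          = []
divideBy c (a ∷ [])    = []
divideBy c (a ∷ b ∷ p) = evalP (b ∷ p) c ∷ divideBy c (b ∷ p)

length-divideBy : ∀ c a p → length (divideBy c (a ∷ p)) ≡ length p
length-divideBy c a []      = refl
length-divideBy c a (b ∷ p) = cong suc (length-divideBy c b p)

evalP-divideBy : ∀ c p x → evalP p x ≡ (x - c) * evalP (divideBy c p) x + evalP p c
evalP-divideBy c []          x = sym (trans (ℚ.+-identityʳ _) (ℚ.*-zeroʳ (x - c)))
evalP-divideBy c (a ∷ [])    x = ring a x c
  where
  ring : ∀ a x c → a + x * 0ℚ ≡ (x - c) * 0ℚ + (a + c * 0ℚ)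
  ring = solve-∀ ℚ-ring
evalP-divideBy c (a ∷ b ∷ p) x =
  trans (cong (λ e → a + x * e) (evalP-divideBy c (b ∷ p) x))
        (ring a x c (evalP (divideBy c (b ∷ p)) x) (evalP (b ∷ p) c))
  where
  ring : ∀ a x c Q e → a + x * ((x - c) * Q + e) ≡ (x - c) * (e + x * Q) + (a + c * e)
  ring = solve-∀ ℚ-ring

divideBy-≈0 : ∀ c p → evalP p c ≡ 0ℚ → (∀ i → coeffP (divideBy c p) i ≡ 0ℚ) → ∀ i → coeffP p i ≡ 0ℚ
divideBy-≈0 c []          _    _  i             = refl
divideBy-≈0 c (a ∷ [])    p[c]≡0 _ zero         = trans (sym (a+d*0≡a a c)) p[c]≡0
divideBy-≈0 c (a ∷ [])    _    _  (suc i)       = refl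
divideBy-≈0 c (a ∷ b ∷ p) p[c]≡0 Q≈0 zero    = begin
  a                                             ≡⟨ ring a c (evalP (b ∷ p) c) ⟩
  (a + c * evalP (b ∷ p) c) - c * evalP (b ∷ p) c ≡⟨ cong₂ (λ u w → u - c * w) p[c]≡0 (Q≈0 0) ⟩
  0ℚ - c * 0ℚ                                   ≡⟨ cong (λ u → 0ℚ - u) (ℚ.*-zeroʳ c) ⟩
  0ℚ                                            ∎
  where
  open ≡-Reasoning
  ring : ∀ a c e → a ≡ (a + c * e) - c * e
  ring = solve-∀ ℚ-ring
divideBy-≈0 c (a ∷ b ∷ p) _    Q≈0 (suc i) =
  divideBy-≈0 c (b ∷ p) (Q≈0 0) (λ j → Q≈0 (suc j)) i

vanishing⇒≈0 : ∀ n p B → length p ≤ n → (∀ t → evalP p (ι (B ℕ.+ t)) ≡ 0ℚ) → ∀ i → coeffP p i ≡ 0ℚ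
vanishing⇒≈0 n       []      B _         _      i = refl
vanishing⇒≈0 (suc n) (a ∷ p) B (s≤s p≤n) vanish   =
  divideBy-≈0 c (a ∷ p) p[c]≡0 (vanishing⇒≈0 n Q (suc B) Q≤n Q-vanish)
  where
  open ≡-Reasoning
  c = ι B
  Q = divideBy c (a ∷ p)
  Q≤n : length Q ≤ n
  Q≤n = subst (_≤ n) (sym (length-divideBy c a p)) p≤n
  p[c]≡0 : evalP (a ∷ p) c ≡ 0ℚ
  p[c]≡0 = subst (λ b → evalP (a ∷ p) (ι b) ≡ 0ℚ) (ℕ.+-identityʳ B) (vanish 0)
  Q-vanish : ∀ t → evalP Q (ι (suc B ℕ.+ t)) ≡ 0ℚ
  Q-vanish t = *-cancelˡ x-c≢0 (begin
    (x - c) * evalP Q x                  ≡⟨ ℚ.+-identityʳ _ ⟨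
    (x - c) * evalP Q x + 0ℚ             ≡⟨ cong ((x - c) * evalP Q x +_) p[c]≡0 ⟨
    (x - c) * evalP Q x + evalP (a ∷ p) c ≡⟨ evalP-divideBy c (a ∷ p) x ⟨
    evalP (a ∷ p) x                      ≡⟨ subst (λ b → evalP (a ∷ p) (ι b) ≡ 0ℚ) (ℕ.+-suc B t) (vanish (suc t)) ⟩
    0ℚ                                   ≡⟨ ℚ.*-zeroʳ (x - c) ⟨
    (x - c) * 0ℚ                         ∎)
    where
    x = ι (suc B ℕ.+ t)
    x-c≢0 : x - c ≢ 0ℚ
    x-c≢0 x-c≡0 = ℚ.<⇒≢ (ι-strictlyIncreasing (s≤s (ℕ.m≤m+n B t))) (sym (x-y≡0⇒x≡y x-c≡0))

point : ℕ → ℚ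
point t = ι (2 ℕ.+ t)

≈P-byEvaluation : ∀ p p' → (∀ t → evalP p (point t) ≡ evalP p' (point t)) → p ≈P p'
≈P-byEvaluation p p' agree i = x-y≡0⇒x≡y (begin
  coeffP p i - coeffP p' i  ≡⟨ trans (coeffP-+P p (map -_ p') i) (cong (coeffP p i +_) (coeffP-neg p' i)) ⟨
  coeffP d i                ≡⟨ vanishing⇒≈0 (length d) d 2 ℕ.≤-refl d-vanish i ⟩
  0ℚ                        ∎)
  where
  open ≡-Reasoning
  d = p +P map -_ p'
  d-vanish : ∀ t → evalP d (point t) ≡ 0ℚ
  d-vanish t = begin
    evalP d (point t)                           ≡⟨ evalP-+P p (map -_ p') (point t) ⟩
    evalP p (point t) + evalP (map -_ p') (point t) ≡⟨ cong₂ _+_ (agree t) (evalP-neg p' (point t)) ⟩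
    evalP p' (point t) - evalP p' (point t)     ≡⟨ ℚ.+-inverseʳ (evalP p' (point t)) ⟩
    0ℚ                                          ∎

numAt denAt : RF → ℚ → ℚ
numAt x z = evalP (num x) z
denAt x z = evalP (den x) z

evalF : ℚ → RF → ℚ
evalF z x = numAt x z * inv (denAt x z)

infix 4 _↦[_]_

record _↦[_]_ (x : RF) (z a : ℚ) : Set where
  constructor defined
  field
    den≢0 : denAt x z ≢ 0ℚ
    num≡  : numAt x z ≡ a * denAt x z

↦-evalF : ∀ x {z} → denAt x z ≢ 0ℚ → x ↦[ z ] evalF z x
↦-evalF x {z} den≢0 = defined den≢0 (begin
  numAt x z                              ≡⟨ ℚ.*-identityʳ _ ⟨
  numAt x z * 1ℚ                         ≡⟨ cong (numAt x z *_) (*-invˡ den≢0) ⟨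
  numAt x z * (inv (denAt x z) * denAt x z) ≡⟨ ℚ.*-assoc (numAt x z) (inv (denAt x z)) (denAt x z) ⟨
  evalF z x * denAt x z                  ∎)
  where open ≡-Reasoning

↦⇒evalF≡ : ∀ {x z a} → x ↦[ z ] a → evalF z x ≡ a
↦⇒evalF≡ {x} {z} {a} (defined den≢0 num≡) = begin
  numAt x z * inv (denAt x z)              ≡⟨ cong (_* inv (denAt x z)) num≡ ⟩
  a * denAt x z * inv (denAt x z)          ≡⟨ ℚ.*-assoc a (denAt x z) (inv (denAt x z)) ⟩
  a * (denAt x z * inv (denAt x z))        ≡⟨ cong (a *_) (*-invʳ den≢0) ⟩
  a * 1ℚ                                   ≡⟨ ℚ.*-identityʳ a ⟩
  a                                        ∎
  where open ≡-Reasoning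

↦-crossAt : ∀ {x y z a} → x ↦[ z ] a → y ↦[ z ] a →
            evalP (num x *P den y) z ≡ evalP (num y *P den x) z
↦-crossAt {x} {y} {z} {a} (defined _ x≡) (defined _ y≡) = begin
  evalP (num x *P den y) z       ≡⟨ evalP-*P (num x) (den y) z ⟩
  numAt x z * denAt y z          ≡⟨ cong (_* denAt y z) x≡ ⟩
  a * denAt x z * denAt y z      ≡⟨ ring a (denAt x z) (denAt y z) ⟩
  a * denAt y z * denAt x z      ≡⟨ cong (_* denAt x z) y≡ ⟨
  numAt y z * denAt x z          ≡⟨ evalP-*P (num y) (den x) z ⟨
  evalP (num y *P den x) z       ∎
  where
  open ≡-Reasoning
  ring : ∀ a d e → a * d * e ≡ a * e * d
  ring = solve-∀ ℚ-ring

≈F-byEvaluation : ∀ x y (a : ℕ → ℚ) → (∀ t → x ↦[ point t ] a t) → (∀ t → y ↦[ point t ] a t) → x ≈F y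
≈F-byEvaluation x y a x↦a y↦a = ≈P-byEvaluation (num x *P den y) (num y *P den x) (λ t → ↦-crossAt (x↦a t) (y↦a t))

numAt-+F : ∀ x y z → numAt (x +F y) z ≡ numAt x z * denAt y z + numAt y z * denAt x z
numAt-+F (a // b) (c // d) z =
  trans (evalP-+P (a *P d) (c *P b) z) (cong₂ _+_ (evalP-*P a d z) (evalP-*P c b z))

denAt-+F : ∀ x y z → denAt (x +F y) z ≡ denAt x z * denAt y z
denAt-+F (a // b) (c // d) z = evalP-*P b d z

numAt-*F : ∀ x y z → numAt (x *F y) z ≡ numAt x z * numAt y z
numAt-*F (a // b) (c // d) z = evalP-*P a c z

denAt-*F : ∀ x y z → denAt (x *F y) z ≡ denAt x z * denAt y z
denAt-*F (a // b) (c // d) z = evalP-*P b d z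

numAt-/F : ∀ x y z → numAt (x /F y) z ≡ numAt x z * denAt y z
numAt-/F (a // b) (c // d) z = evalP-*P a d z

denAt-/F : ∀ x y z → denAt (x /F y) z ≡ denAt x z * numAt y z
denAt-/F (a // b) (c // d) z = evalP-*P b c z

numAt-negF : ∀ x z → numAt (-F x) z ≡ - numAt x z
numAt-negF (a // b) z = evalP-neg a z

denAt-negF : ∀ x z → denAt (-F x) z ≡ denAt x z
denAt-negF (a // b) z = refl

evalF-negF : ∀ z x → evalF z (-F x) ≡ - evalF z x
evalF-negF z x = trans (cong₂ (λ n d → n * inv d) (numAt-negF x z) (denAt-negF x z)) (sym (ℚ.neg-distribˡ-* (numAt x z) (inv (denAt x z))))

evalP-singleton : ∀ a z → evalP (a ∷ []) z ≡ a
evalP-singleton a z = trans (cong (a +_) (ℚ.*-zeroʳ z)) (ℚ.+-identityʳ a)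

↦-constF : ∀ a z → constF a ↦[ z ] a
↦-constF a z = defined den≢0 (trans (evalP-singleton a z) (sym (trans (cong (a *_) (evalP-singleton 1ℚ z)) (ℚ.*-identityʳ a))))
  where
  den≢0 : denAt (constF a) z ≢ 0ℚ
  den≢0 = subst (_≢ 0ℚ) (sym (evalP-singleton 1ℚ z)) ℚ.1≢0

↦-+F : ∀ {x y z a b} → x ↦[ z ] a → y ↦[ z ] b → x +F y ↦[ z ] a + b
↦-+F {x} {y} {z} {a} {b} (defined dx≢0 x≡) (defined dy≢0 y≡) =
  defined (subst (_≢ 0ℚ) (sym (denAt-+F x y z)) (*-≢0 dx≢0 dy≢0)) (begin
    numAt (x +F y) z                          ≡⟨ numAt-+F x y z ⟩
    numAt x z * denAt y z + numAt y z * denAt x z ≡⟨ cong₂ (λ u w → u * denAt y z + w * denAt x z) x≡ y≡ ⟩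
    a * denAt x z * denAt y z + b * denAt y z * denAt x z ≡⟨ ring a b (denAt x z) (denAt y z) ⟩
    (a + b) * (denAt x z * denAt y z)        ≡⟨ cong ((a + b) *_) (denAt-+F x y z) ⟨
    (a + b) * denAt (x +F y) z               ∎)
  where
  open ≡-Reasoning
  ring : ∀ a b d e → a * d * e + b * e * d ≡ (a + b) * (d * e)
  ring = solve-∀ ℚ-ring

↦-*F : ∀ {x y z a b} → x ↦[ z ] a → y ↦[ z ] b → x *F y ↦[ z ] a * b
↦-*F {x} {y} {z} {a} {b} (defined dx≢0 x≡) (defined dy≢0 y≡) =
  defined (subst (_≢ 0ℚ) (sym (denAt-*F x y z)) (*-≢0 dx≢0 dy≢0)) (begin
    numAt (x *F y) z                         ≡⟨ numAt-*F x y z ⟩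
    numAt x z * numAt y z                    ≡⟨ cong₂ _*_ x≡ y≡ ⟩
    a * denAt x z * (b * denAt y z)          ≡⟨ ring a (denAt x z) b (denAt y z) ⟩
    (a * b) * (denAt x z * denAt y z)        ≡⟨ cong ((a * b) *_) (denAt-*F x y z) ⟨
    (a * b) * denAt (x *F y) z               ∎)
  where
  open ≡-Reasoning
  ring : ∀ a d b e → a * d * (b * e) ≡ (a * b) * (d * e)
  ring = solve-∀ ℚ-ring

↦-negF : ∀ {x z a} → x ↦[ z ] a → -F x ↦[ z ] - a
↦-negF {x} {z} {a} (defined dx≢0 x≡) = defined dx≢0
  (trans (numAt-negF x z) (trans (cong -_ x≡) (trans (ℚ.neg-distribˡ-* a (denAt x z)) (cong (- a *_) (sym (denAt-negF x z))))))

↦-vF : ∀ z → vF ↦[ z ] z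
↦-vF z = defined (subst (_≢ 0ℚ) (sym (evalP-singleton 1ℚ z)) ℚ.1≢0) (ring z)
  where
  ring : ∀ z → 0ℚ + z * (1ℚ + z * 0ℚ) ≡ z * (1ℚ + z * 0ℚ)
  ring = solve-∀ ℚ-ring

↦-v⁻¹F : ∀ {z} → z ≢ 0ℚ → v⁻¹F ↦[ z ] inv z
↦-v⁻¹F {z} z≢0 = defined (subst (_≢ 0ℚ) (sym (evalP-v z)) z≢0) (begin
  1ℚ + z * 0ℚ             ≡⟨ evalP-singleton 1ℚ z ⟩
  1ℚ                      ≡⟨ *-invˡ z≢0 ⟨
  inv z * z               ≡⟨ cong (inv z *_) (evalP-v z) ⟨
  inv z * denAt v⁻¹F z    ∎)
  where
  open ≡-Reasoning
  evalP-v : ∀ z → evalP (0ℚ ∷ 1ℚ ∷ []) z ≡ z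
  evalP-v z = trans (ℚ.+-identityˡ _) (trans (cong (z *_) (evalP-singleton 1ℚ z)) (ℚ.*-identityʳ z))

↦-barF : ∀ {x z a} → z ≢ 0ℚ → x ↦[ inv z ] a → barF x ↦[ z ] a
↦-barF {n // d} {z} {a} z≢0 (defined d≢0 n≡) = defined den≢0 (*-cancelˡ z≢0 (begin
  z * evalP (flipP D n) z         ≡⟨ evalP-flipP D n z≢0 (ℕ.m≤m⊔n (length n) (length d)) ⟩
  z ^ D * evalP n (inv z)         ≡⟨ cong (z ^ D *_) n≡ ⟩
  z ^ D * (a * evalP d (inv z))   ≡⟨ x∙yz≡y∙xz (z ^ D) a (evalP d (inv z)) ⟩
  a * (z ^ D * evalP d (inv z))   ≡⟨ cong (a *_) flip-d ⟨
  a * (z * evalP (flipP D d) z)   ≡⟨ x∙yz≡y∙xz a z (evalP (flipP D d) z) ⟩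
  z * (a * evalP (flipP D d) z)   ∎))
  where
  open ≡-Reasoning
  D = length n ⊔ length d
  flip-d : z * evalP (flipP D d) z ≡ z ^ D * evalP d (inv z)
  flip-d = evalP-flipP D d z≢0 (ℕ.m≤n⊔m (length n) (length d))
  den≢0 : evalP (flipP D d) z ≢ 0ℚ
  den≢0 fd≡0 = *-≢0 (^-≢0 D z≢0) d≢0 (trans (sym flip-d) (trans (cong (z *_) fd≡0) (ℚ.*-zeroʳ z)))

numAt-^F : ∀ x r z → numAt (x ^F r) z ≡ numAt x z ^ r
numAt-^F x zero    z = evalP-singleton 1ℚ z
numAt-^F x (suc r) z = trans (numAt-*F x (x ^F r) z) (cong (numAt x z *_) (numAt-^F x r z))

denAt-^F : ∀ x r z → denAt (x ^F r) z ≡ denAt x z ^ r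
denAt-^F x zero    z = evalP-singleton 1ℚ z
denAt-^F x (suc r) z = trans (denAt-*F x (x ^F r) z) (cong (denAt x z *_) (denAt-^F x r z))

numAt-vF : ∀ z → numAt vF z ≡ z
numAt-vF z = trans (ℚ.+-identityˡ _) (trans (cong (z *_) (evalP-singleton 1ℚ z)) (ℚ.*-identityʳ z))

denAt-vF : ∀ z → denAt vF z ≡ 1ℚ
denAt-vF = evalP-singleton 1ℚ

numAt-v⁻¹F : ∀ z → numAt v⁻¹F z ≡ 1ℚ
numAt-v⁻¹F = evalP-singleton 1ℚ

denAt-v⁻¹F : ∀ z → denAt v⁻¹F z ≡ z
denAt-v⁻¹F = numAt-vF

numAt-v-v⁻¹ : ∀ z → numAt (vF -F v⁻¹F) z ≡ z * z - 1ℚ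
numAt-v-v⁻¹ z = begin
  numAt (vF -F v⁻¹F) z                                        ≡⟨ numAt-+F vF (-F v⁻¹F) z ⟩
  numAt vF z * denAt (-F v⁻¹F) z + numAt (-F v⁻¹F) z * denAt vF z
    ≡⟨ cong₂ (λ u w → numAt vF z * u + w * denAt vF z) (denAt-negF v⁻¹F z) (numAt-negF v⁻¹F z) ⟩
  numAt vF z * denAt v⁻¹F z + - numAt v⁻¹F z * denAt vF z
    ≡⟨ cong₂ _+_ (cong₂ _*_ (numAt-vF z) (denAt-v⁻¹F z)) (cong₂ (λ u w → - u * w) (numAt-v⁻¹F z) (denAt-vF z)) ⟩
  z * z + - 1ℚ * 1ℚ                                           ≡⟨ cong (z * z +_) (ℚ.*-identityʳ (- 1ℚ)) ⟩
  z * z - 1ℚ                                                  ∎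
  where open ≡-Reasoning

denAt-v-v⁻¹ : ∀ z → denAt (vF -F v⁻¹F) z ≡ z
denAt-v-v⁻¹ z = begin
  denAt (vF -F v⁻¹F) z           ≡⟨ denAt-+F vF (-F v⁻¹F) z ⟩
  denAt vF z * denAt v⁻¹F z      ≡⟨ cong₂ _*_ (denAt-vF z) (denAt-v⁻¹F z) ⟩
  1ℚ * z                         ≡⟨ ℚ.*-identityˡ z ⟩
  z                              ∎
  where open ≡-Reasoning

numAt-vʳ : ∀ r z → numAt (vF ^F r) z ≡ z ^ r
numAt-vʳ r z = trans (numAt-^F vF r z) (cong (_^ r) (numAt-vF z))

denAt-vʳ : ∀ r z → denAt (vF ^F r) z ≡ 1ℚ
denAt-vʳ r z = trans (denAt-^F vF r z) (trans (cong (_^ r) (denAt-vF z)) (1^n≡1 r))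

numAt-v⁻ʳ : ∀ r z → numAt (v⁻¹F ^F r) z ≡ 1ℚ
numAt-v⁻ʳ r z = trans (numAt-^F v⁻¹F r z) (trans (cong (_^ r) (numAt-v⁻¹F z)) (1^n≡1 r))

denAt-v⁻ʳ : ∀ r z → denAt (v⁻¹F ^F r) z ≡ z ^ r
denAt-v⁻ʳ r z = trans (denAt-^F v⁻¹F r z) (cong (_^ r) (denAt-v⁻¹F z))

numAt-vʳ-v⁻ʳ : ∀ r z → numAt ((vF ^F r) -F (v⁻¹F ^F r)) z ≡ z ^ r * z ^ r - 1ℚ
numAt-vʳ-v⁻ʳ r z = begin
  numAt ((vF ^F r) -F (v⁻¹F ^F r)) z
    ≡⟨ numAt-+F (vF ^F r) (-F (v⁻¹F ^F r)) z ⟩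
  numAt (vF ^F r) z * denAt (-F (v⁻¹F ^F r)) z + numAt (-F (v⁻¹F ^F r)) z * denAt (vF ^F r) z
    ≡⟨ cong₂ (λ u w → numAt (vF ^F r) z * u + w * denAt (vF ^F r) z) (denAt-negF (v⁻¹F ^F r) z) (numAt-negF (v⁻¹F ^F r) z) ⟩
  numAt (vF ^F r) z * denAt (v⁻¹F ^F r) z + - numAt (v⁻¹F ^F r) z * denAt (vF ^F r) z
    ≡⟨ cong₂ _+_ (cong₂ _*_ (numAt-vʳ r z) (denAt-v⁻ʳ r z)) (cong₂ (λ u w → - u * w) (numAt-v⁻ʳ r z) (denAt-vʳ r z)) ⟩
  z ^ r * z ^ r + - 1ℚ * 1ℚ
    ≡⟨ cong (z ^ r * z ^ r +_) (ℚ.*-identityʳ (- 1ℚ)) ⟩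
  z ^ r * z ^ r - 1ℚ ∎
  where open ≡-Reasoning

denAt-vʳ-v⁻ʳ : ∀ r z → denAt ((vF ^F r) -F (v⁻¹F ^F r)) z ≡ z ^ r
denAt-vʳ-v⁻ʳ r z = begin
  denAt ((vF ^F r) -F (v⁻¹F ^F r)) z          ≡⟨ denAt-+F (vF ^F r) (-F (v⁻¹F ^F r)) z ⟩
  denAt (vF ^F r) z * denAt (v⁻¹F ^F r) z     ≡⟨ cong₂ _*_ (denAt-vʳ r z) (denAt-v⁻ʳ r z) ⟩
  1ℚ * z ^ r                                  ≡⟨ ℚ.*-identityˡ (z ^ r) ⟩
  z ^ r                                       ∎
  where open ≡-Reasoning

ratio : ℕ → RF
ratio r = (vF ^F r) /F qint r

numAt-ratio : ∀ r z → numAt (ratio r) z ≡ z ^ r * (z ^ r * (z * z - 1ℚ))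
numAt-ratio r z = begin
  numAt (ratio r) z
    ≡⟨ numAt-/F (vF ^F r) (qint r) z ⟩
  numAt (vF ^F r) z * denAt (qint r) z
    ≡⟨ cong₂ _*_ (numAt-vʳ r z) (denAt-/F ((vF ^F r) -F (v⁻¹F ^F r)) (vF -F v⁻¹F) z) ⟩
  z ^ r * (denAt ((vF ^F r) -F (v⁻¹F ^F r)) z * numAt (vF -F v⁻¹F) z)
    ≡⟨ cong (z ^ r *_) (cong₂ _*_ (denAt-vʳ-v⁻ʳ r z) (numAt-v-v⁻¹ z)) ⟩
  z ^ r * (z ^ r * (z * z - 1ℚ)) ∎
  where open ≡-Reasoning

denAt-ratio : ∀ r z → denAt (ratio r) z ≡ (z ^ r * z ^ r - 1ℚ) * z
denAt-ratio r z = begin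
  denAt (ratio r) z
    ≡⟨ denAt-/F (vF ^F r) (qint r) z ⟩
  denAt (vF ^F r) z * numAt (qint r) z
    ≡⟨ cong₂ _*_ (denAt-vʳ r z) (numAt-/F ((vF ^F r) -F (v⁻¹F ^F r)) (vF -F v⁻¹F) z) ⟩
  1ℚ * (numAt ((vF ^F r) -F (v⁻¹F ^F r)) z * denAt (vF -F v⁻¹F) z)
    ≡⟨ ℚ.*-identityˡ _ ⟩
  numAt ((vF ^F r) -F (v⁻¹F ^F r)) z * denAt (vF -F v⁻¹F) z
    ≡⟨ cong₂ _*_ (numAt-vʳ-v⁻ʳ r z) (denAt-v-v⁻¹ z) ⟩
  (z ^ r * z ^ r - 1ℚ) * z ∎
  where open ≡-Reasoning

ratio-value : ∀ r {z} → denAt (ratio r) z ≢ 0ℚ →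
              evalF z (ratio r) * ((z ^ r * z ^ r - 1ℚ) * z) ≡ z ^ r * (z ^ r * (z * z - 1ℚ))
ratio-value r {z} den≢0 = begin
  evalF z (ratio r) * ((z ^ r * z ^ r - 1ℚ) * z)   ≡⟨ cong (evalF z (ratio r) *_) (denAt-ratio r z) ⟨
  evalF z (ratio r) * denAt (ratio r) z            ≡⟨ _↦[_]_.num≡ (↦-evalF (ratio r) den≢0) ⟨
  numAt (ratio r) z                                ≡⟨ numAt-ratio r z ⟩
  z ^ r * (z ^ r * (z * z - 1ℚ))                   ∎
  where open ≡-Reasoning

Coeffs : Set
Coeffs = Seq → ℚ

infix 4 _≗[_]_

_≗[_]_ : Coeffs → ℕ → Coeffs → Set
f ≗[ N ] g = ∀ ε → length ε ≡ N → f ε ≡ g ε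

Local : (Coeffs → Coeffs) → Set
Local Φ = ∀ {N f g} → f ≗[ N ] g → Φ f ≗[ N ] Φ g

Homogeneous : (Coeffs → Coeffs) → Set
Homogeneous Φ = ∀ c g ε → Φ (λ δ → c * g δ) ε ≡ c * Φ g ε

-- The coefficients of +ᵃ ⊗ m, given those of m.
prefixPlus : ℕ → Coeffs → Coeffs
prefixPlus zero    g ε           = g ε
prefixPlus (suc a) g (true ∷ ε)  = prefixPlus a g ε
prefixPlus (suc a) g (false ∷ ε) = 0ℚ
prefixPlus (suc a) g []          = 0ℚ

_∣last_ : Coeffs → Bool → Coeffs
(g ∣last x) δ = g (δ ++ x ∷ [])

prefixPlus-homogeneous : ∀ a → Homogeneous (prefixPlus a)
prefixPlus-homogeneous zero    c g ε           = refl
prefixPlus-homogeneous (suc a) c g (true ∷ ε)  = prefixPlus-homogeneous a c g ε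
prefixPlus-homogeneous (suc a) c g (false ∷ ε) = sym (ℚ.*-zeroʳ c)
prefixPlus-homogeneous (suc a) c g []          = sym (ℚ.*-zeroʳ c)

prefixPlus-cong : ∀ a {N f g} → f ≗[ N ] g → prefixPlus a f ≗[ a ℕ.+ N ] prefixPlus a g
prefixPlus-cong zero    f≗g ε           |ε| = f≗g ε |ε|
prefixPlus-cong (suc a) f≗g (true ∷ ε)  |ε| = prefixPlus-cong a f≗g ε (ℕ.suc-injective |ε|)
prefixPlus-cong (suc a) f≗g (false ∷ ε) |ε| = refl
prefixPlus-cong (suc a) f≗g []          |ε| = refl

prefixPlus-≗ : ∀ a {f g} → (∀ δ → f δ ≡ g δ) → ∀ ε → prefixPlus a f ε ≡ prefixPlus a g ε
prefixPlus-≗ zero    f≗g ε           = f≗g ε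
prefixPlus-≗ (suc a) f≗g (true ∷ ε)  = prefixPlus-≗ a f≗g ε
prefixPlus-≗ (suc a) f≗g (false ∷ ε) = refl
prefixPlus-≗ (suc a) f≗g []          = refl

prefixPlus-suc : ∀ a g ε → prefixPlus (suc a) g ε ≡ prefixPlus a (prefixPlus 1 g) ε
prefixPlus-suc zero    g ε           = refl
prefixPlus-suc (suc a) g (true ∷ ε)  = prefixPlus-suc a g ε
prefixPlus-suc (suc a) g (false ∷ ε) = refl
prefixPlus-suc (suc a) g []          = refl

prefixPlus-∣last : ∀ a g x ε → a ≤ length ε → (prefixPlus a g ∣last x) ε ≡ prefixPlus a (g ∣last x) ε
prefixPlus-∣last zero    g x ε           _         = refl
prefixPlus-∣last (suc a) g x (true ∷ ε)  (s≤s a≤ε) = prefixPlus-∣last a g x ε a≤ε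
prefixPlus-∣last (suc a) g x (false ∷ ε) _         = refl

single : Seq → ℚ → Coeffs
single δ x ε = if does (List.≡-dec Bool._≟_ δ ε) then x else 0ℚ

single-scale : ∀ δ x ε → single δ x ε ≡ x * single δ 1ℚ ε
single-scale δ x ε with does (List.≡-dec Bool._≟_ δ ε)
... | true  = sym (ℚ.*-identityʳ x)
... | false = sym (ℚ.*-zeroʳ x)

single-≢ : ∀ δ x ε → δ ≢ ε → single δ x ε ≡ 0ℚ
single-≢ δ x ε δ≢ε with List.≡-dec Bool._≟_ δ ε
... | yes δ≡ε = ⊥-elim (δ≢ε δ≡ε)
... | no  _   = refl

single-≢length : ∀ δ x ε → length δ ≢ length ε → single δ x ε ≡ 0ℚ
single-≢length δ x ε δ≢ε = single-≢ δ x ε (δ≢ε ∘ cong length)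

single-refl : ∀ δ x → single δ x δ ≡ x
single-refl δ x with List.≡-dec Bool._≟_ δ δ
... | yes _   = refl
... | no  δ≢δ = ⊥-elim (δ≢δ refl)

single-pluses : ∀ a δ x ε → single (replicate a true ++ δ) x ε ≡ prefixPlus a (single δ x) ε
single-pluses zero    δ x ε           = refl
single-pluses (suc a) δ x (true ∷ ε)  = single-pluses a δ x ε
single-pluses (suc a) δ x (false ∷ ε) = refl
single-pluses (suc a) δ x []          = refl

snoc-view : ∀ (ε : Seq) L → length ε ≡ suc L → ∃ λ ε' → ∃ λ y → (ε ≡ ε' ++ y ∷ []) × (length ε' ≡ L)
snoc-view (a ∷ [])     zero    _     = [] , a , refl , refl
snoc-view (a ∷ b ∷ ε)  zero    ()
snoc-view (a ∷ ε)      (suc L) |ε| with snoc-view ε L (ℕ.suc-injective |ε|)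
... | ε' , y , refl , |ε'| = a ∷ ε' , y , refl , cong suc |ε'|

suc-∸-suc : ∀ {n a} → a < n → suc (n ∸ suc a) ≡ n ∸ a
suc-∸-suc a<n = sym (ℕ.+-∸-assoc 1 a<n)

≤ᵇ-true : ∀ a b → a ≤ b → (a ≤ᵇ b) ≡ true
≤ᵇ-true a b a≤b = Equivalence.to Bool.T-≡ (ℕ.≤⇒≤ᵇ a≤b)

≤ᵇ-false : ∀ a b → b < a → (a ≤ᵇ b) ≡ false
≤ᵇ-false a b b<a = Bool.¬-not (λ a≤ᵇb → ℕ.<⇒≱ b<a (ℕ.≤ᵇ⇒≤ a b (Equivalence.from Bool.T-≡ a≤ᵇb)))

module Rectangle (k m : ℕ) where

  lam : List ℕ
  lam = replicate k m

  row-inside : ∀ i → 1 ≤ i → i ≤ k → row lam i ≡ m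
  row-inside i 1≤i i≤k = go k i 1≤i i≤k
    where
    go : ∀ k i → 1 ≤ i → i ≤ k → row (replicate k m) i ≡ m
    go (suc k) (suc zero)    _ _         = refl
    go (suc k) (suc (suc i)) _ (s≤s i≤k) = go k (suc i) (s≤s z≤n) i≤k

  row-below : ∀ i → k < i → row lam i ≡ 0
  row-below i k<i = go k i k<i
    where
    go : ∀ k i → k < i → row (replicate k m) i ≡ 0
    go zero    i             _         = refl
    go (suc k) (suc (suc i)) (s≤s k<i) = go k (suc i) k<i

  rAux-right : ∀ f i → 1 ≤ i → rAux lam f i (suc m) ≡ 0
  rAux-right zero    i       _ = refl
  rAux-right (suc f) (suc i) _ with ℕ.≤-total (suc i) k
  ... | inj₁ i<k rewrite row-inside (suc i) (s≤s z≤n) i<k | ≤ᵇ-false (suc m) m (ℕ.n<1+n m) = refl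
  ... | inj₂ k≤i with ℕ.m≤n⇒m<n∨m≡n k≤i
  ...   | inj₁ k<i  rewrite row-below (suc i) k<i = refl
  ...   | inj₂ refl rewrite row-inside (suc i) (s≤s z≤n) ℕ.≤-refl | ≤ᵇ-false (suc m) m (ℕ.n<1+n m) = refl

  rAux-below : ∀ f j → rAux lam f (suc k) j ≡ 0
  rAux-below zero    j       = refl
  rAux-below (suc f) zero    = refl
  rAux-below (suc f) (suc j) rewrite row-below (suc k) ℕ.≤-refl = refl

  -- Measured from the far corner (k, m) of the rectangle.
  rAux-corner : ∀ f a b → a < k → b < m → a ℕ.+ b < f → rAux lam f (k ∸ a) (m ∸ b) ≡ suc (a ℕ.+ b)
  rAux-corner (suc f) a b a<k b<m (s≤s a+b≤f) = begin
    rAux lam (suc f) (k ∸ a) (m ∸ b)                                  ≡⟨ unfold ⟩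
    suc (rAux lam f (k ∸ a) (suc (m ∸ b)) ⊔ rAux lam f (suc (k ∸ a)) (m ∸ b))
                                                                      ≡⟨ cong suc (cong₂ _⊔_ (right b b<m a+b≤f) (below a a<k a+b≤f)) ⟩
    suc (upTo b (a ℕ.+ b) ⊔ upTo a (a ℕ.+ b))                         ≡⟨ combine a b ⟩
    suc (a ℕ.+ b)                                                     ∎
    where
    open ≡-Reasoning
    upTo : ℕ → ℕ → ℕ
    upTo zero    s = 0
    upTo (suc _) s = s
    inside : inBox lam (k ∸ a) (m ∸ b) ≡ true
    inside rewrite sym (suc-∸-suc a<k) | sym (suc-∸-suc b<m)
                 | row-inside (suc (k ∸ suc a)) (s≤s z≤n) (subst (_≤ k) (sym (suc-∸-suc a<k)) (ℕ.m∸n≤m k a)) =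
      ≤ᵇ-true (suc (m ∸ suc b)) m (subst (_≤ m) (sym (suc-∸-suc b<m)) (ℕ.m∸n≤m m b))
    unfold : rAux lam (suc f) (k ∸ a) (m ∸ b) ≡ suc (rAux lam f (k ∸ a) (suc (m ∸ b)) ⊔ rAux lam f (suc (k ∸ a)) (m ∸ b))
    unfold rewrite inside = refl
    right : ∀ b → b < m → a ℕ.+ b ≤ f → rAux lam f (k ∸ a) (suc (m ∸ b)) ≡ upTo b (a ℕ.+ b)
    right zero     _   _     = rAux-right f (k ∸ a) (subst (1 ≤_) (suc-∸-suc a<k) (s≤s z≤n))
    right (suc b′) b<m a+b≤f = trans (cong (rAux lam f (k ∸ a)) (suc-∸-suc (ℕ.<-trans (ℕ.n<1+n b′) b<m)))
      (trans (rAux-corner f a b′ a<k (ℕ.<-trans (ℕ.n<1+n b′) b<m) (subst (_≤ f) (ℕ.+-suc a b′) a+b≤f)) (sym (ℕ.+-suc a b′)))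
    below : ∀ a → a < k → a ℕ.+ b ≤ f → rAux lam f (suc (k ∸ a)) (m ∸ b) ≡ upTo a (a ℕ.+ b)
    below zero     _   _     = rAux-below f (m ∸ b)
    below (suc a′) a<k a+b≤f = trans (cong (λ i → rAux lam f i (m ∸ b)) (suc-∸-suc (ℕ.<-trans (ℕ.n<1+n a′) a<k)))
      (rAux-corner f a′ b (ℕ.<-trans (ℕ.n<1+n a′) a<k) b<m a+b≤f)
    combine : ∀ a b → suc (upTo b (a ℕ.+ b) ⊔ upTo a (a ℕ.+ b)) ≡ suc (a ℕ.+ b)
    combine zero     zero     = refl
    combine zero     (suc b′) = cong suc (ℕ.⊔-identityʳ (suc b′))
    combine (suc a′) zero     = refl
    combine (suc a′) (suc b′) = cong suc (ℕ.⊔-idem (suc a′ ℕ.+ suc b′))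

  shift-inside : ∀ i j → 1 ≤ i → i ≤ k → 1 ≤ j → j ≤ m → shift lam i j ≡ suc ((k ∸ i) ℕ.+ (m ∸ j))
  shift-inside i j 1≤i i≤k 1≤j j≤m =
    trans (cong₂ (rAux lam (suc (sum lam))) (sym (ℕ.m∸[m∸n]≡n i≤k)) (sym (ℕ.m∸[m∸n]≡n j≤m)))
          (rAux-corner (suc (sum lam)) (k ∸ i) (m ∸ j) (∸-< k i 1≤i i≤k) (∸-< m j 1≤j j≤m) (s≤s fuel))
    where
    ∸-< : ∀ n i → 1 ≤ i → i ≤ n → n ∸ i < n
    ∸-< (suc n) (suc i) _ (s≤s i≤n) = s≤s (ℕ.m∸n≤m n i)
    sum-lam : sum lam ≡ k ℕ.* m
    sum-lam = go k
      where
      go : ∀ k → sum (replicate k m) ≡ k ℕ.* m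
      go zero    = refl
      go (suc k) = cong (m ℕ.+_) (go k)
    fuel : (k ∸ i) ℕ.+ (m ∸ j) ≤ sum lam
    fuel = subst ((k ∸ i) ℕ.+ (m ∸ j) ≤_) (sym sum-lam) (bound k m i j 1≤i i≤k 1≤j j≤m)
      where
      bound : ∀ k m i j → 1 ≤ i → i ≤ k → 1 ≤ j → j ≤ m → (k ∸ i) ℕ.+ (m ∸ j) ≤ k ℕ.* m
      bound (suc k) (suc m) (suc i) (suc j) _ (s≤s i≤k) _ (s≤s j≤m) = begin
        (k ∸ i) ℕ.+ (m ∸ j)      ≤⟨ ℕ.+-mono-≤ (ℕ.m∸n≤m k i) (ℕ.m∸n≤m m j) ⟩
        k ℕ.+ m                  ≤⟨ ℕ.+-monoˡ-≤ m (ℕ.m≤m*n k (suc m)) ⟩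
        k ℕ.* suc m ℕ.+ m        ≡⟨ ℕ.+-comm (k ℕ.* suc m) m ⟩
        m ℕ.+ k ℕ.* suc m        ≤⟨ ℕ.n≤1+n _ ⟩
        suc k ℕ.* suc m          ∎
        where open ℕ.≤-Reasoning

  index-inside : ∀ i j → i ≤ k → (k ℕ.+ suc j) ∸ i ≡ suc ((k ∸ i) ℕ.+ j)
  index-inside i j i≤k = trans (ℕ.+-∸-comm (suc j) i≤k) (ℕ.+-suc (k ∸ i) j)

wact-++ : ∀ xs ys ε → wact (xs ++ ys) ε ≡ wact xs (wact ys ε)
wact-++ []       ys ε = refl
wact-++ (s ∷ xs) ys ε = cong (swap s) (wact-++ xs ys ε)

swap-at : ∀ γ a b ρ → swap (suc (length γ)) (γ ++ a ∷ b ∷ ρ) ≡ γ ++ b ∷ a ∷ ρ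
swap-at []      a b ρ = refl
swap-at (x ∷ γ) a b ρ = cong (x ∷_) (swap-at γ a b ρ)

replicate-∷ : ∀ {A : Set} L (x : A) β → replicate L x ++ x ∷ β ≡ x ∷ replicate L x ++ β
replicate-∷ zero    x β = refl
replicate-∷ (suc L) x β = cong (x ∷_) (replicate-∷ L x β)

move-plus : ∀ α L β → wact (map (length α ℕ.+_) (downFrom L)) (α ++ true ∷ replicate L false ++ β)
                      ≡ α ++ replicate L false ++ true ∷ β
move-plus α zero    β = refl
move-plus α (suc L) β = begin
  swap (length α ℕ.+ suc L) (wact (map (length α ℕ.+_) (downFrom L)) (α ++ true ∷ replicate (suc L) false ++ β))
    ≡⟨ cong (λ z → swap (length α ℕ.+ suc L) (wact (map (length α ℕ.+_) (downFrom L)) (α ++ true ∷ z))) (replicate-∷ L false β) ⟨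
  swap (length α ℕ.+ suc L) (wact (map (length α ℕ.+_) (downFrom L)) (α ++ true ∷ replicate L false ++ false ∷ β))
    ≡⟨ cong (swap (length α ℕ.+ suc L)) (move-plus α L (false ∷ β)) ⟩
  swap (length α ℕ.+ suc L) (α ++ replicate L false ++ true ∷ false ∷ β)
    ≡⟨ cong₂ swap position (sym (List.++-assoc α (replicate L false) (true ∷ false ∷ β))) ⟩
  swap (suc (length (α ++ replicate L false))) ((α ++ replicate L false) ++ true ∷ false ∷ β)
    ≡⟨ swap-at (α ++ replicate L false) true false β ⟩
  (α ++ replicate L false) ++ false ∷ true ∷ β
    ≡⟨ List.++-assoc α (replicate L false) (false ∷ true ∷ β) ⟩
  α ++ replicate L false ++ false ∷ true ∷ β
    ≡⟨ cong (α ++_) (replicate-∷ L false (true ∷ β)) ⟩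
  α ++ replicate (suc L) false ++ true ∷ β ∎
  where
  open ≡-Reasoning
  position : length α ℕ.+ suc L ≡ suc (length (α ++ replicate L false))
  position = trans (ℕ.+-suc (length α) L)
    (cong suc (sym (trans (List.length-++ α) (cong (length α ℕ.+_) (List.length-replicate L)))))

module RectangleWord (k m : ℕ) where
  open Rectangle k m

  wact-rows : ∀ a → a ≤ k → wact (concat (map (P k lam) (downFrom a))) (replicate k true ++ replicate m false)
                            ≡ replicate (k ∸ a) true ++ replicate m false ++ replicate a true
  wact-rows zero    _   = cong (replicate k true ++_) (sym (List.++-identityʳ (replicate m false)))
  wact-rows (suc a) a<k = begin
    wact (P k lam (suc a) ++ concat (map (P k lam) (downFrom a))) 𝟏
      ≡⟨ wact-++ (P k lam (suc a)) _ 𝟏 ⟩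
    wact (P k lam (suc a)) (wact (concat (map (P k lam) (downFrom a))) 𝟏)
      ≡⟨ cong (wact (P k lam (suc a))) (wact-rows a (ℕ.<⇒≤ a<k)) ⟩
    wact (P k lam (suc a)) (replicate (k ∸ a) true ++ replicate m false ++ replicate a true)
      ≡⟨ cong₂ (λ w l → wact w (replicate l true ++ replicate m false ++ replicate a true)) P-row (sym (suc-∸-suc a<k)) ⟩
    wact (map (length α ℕ.+_) (downFrom m)) (true ∷ α ++ replicate m false ++ replicate a true)
      ≡⟨ cong (wact (map (length α ℕ.+_) (downFrom m))) (replicate-∷ (k ∸ suc a) true _) ⟨
    wact (map (length α ℕ.+_) (downFrom m)) (α ++ true ∷ replicate m false ++ replicate a true)
      ≡⟨ move-plus α m (replicate a true) ⟩
    α ++ replicate m false ++ replicate (suc a) true ∎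
    where
    open ≡-Reasoning
    𝟏 = replicate k true ++ replicate m false
    α = replicate (k ∸ suc a) true
    P-row : P k lam (suc a) ≡ map (length α ℕ.+_) (downFrom m)
    P-row = trans (cong (λ j → map (λ t → (k ℕ.+ t) ∸ suc a) (downFrom j)) (row-inside (suc a) (s≤s z≤n) a<k))
                  (List.map-cong (λ t → trans (ℕ.+-∸-comm t a<k) (cong (ℕ._+ t) (sym (List.length-replicate (k ∸ suc a))))) (downFrom m))

  wact-rectangle : wact (wword k lam) (replicate k true ++ replicate m false) ≡ replicate m false ++ replicate k true
  wact-rectangle = begin
    wact (concat (map (P k lam) (downFrom (length lam)))) 𝟏   ≡⟨ cong (λ a → wact (concat (map (P k lam) (downFrom a))) 𝟏) (List.length-replicate k) ⟩
    wact (concat (map (P k lam) (downFrom k))) 𝟏              ≡⟨ wact-rows k ℕ.≤-refl ⟩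
    replicate (k ∸ k) true ++ replicate m false ++ replicate k true
                                                              ≡⟨ cong (λ l → replicate l true ++ replicate m false ++ replicate k true) (ℕ.n∸n≡0 k) ⟩
    replicate m false ++ replicate k true                     ∎
    where
    open ≡-Reasoning
    𝟏 = replicate k true ++ replicate m false

countMinus : Seq → ℕ
countMinus []          = 0
countMinus (true ∷ ε)  = countMinus ε
countMinus (false ∷ ε) = suc (countMinus ε)

coinv : Seq → ℕ
coinv []          = 0
coinv (true ∷ ε)  = countMinus ε ℕ.+ coinv ε
coinv (false ∷ ε) = coinv ε

length≡countPlus+countMinus : ∀ ε → length ε ≡ countPlus ε ℕ.+ countMinus ε
length≡countPlus+countMinus []          = refl
length≡countPlus+countMinus (true ∷ ε)  = cong suc (length≡countPlus+countMinus ε)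
length≡countPlus+countMinus (false ∷ ε) =
  trans (cong suc (length≡countPlus+countMinus ε)) (sym (ℕ.+-suc (countPlus ε) (countMinus ε)))

coinv≡0⇒sorted : ∀ ε → coinv ε ≡ 0 → ε ≡ replicate (countMinus ε) false ++ replicate (countPlus ε) true
coinv≡0⇒sorted []          _ = refl
coinv≡0⇒sorted (true ∷ ε)  coinv≡0 with countMinus ε in eq
... | zero = cong (true ∷_) (trans (coinv≡0⇒sorted ε coinv≡0) (cong (λ c → replicate c false ++ replicate (countPlus ε) true) eq))
coinv≡0⇒sorted (false ∷ ε) coinv≡0 = cong (false ∷_) (coinv≡0⇒sorted ε coinv≡0)

coinv-sorted : ∀ a b → coinv (replicate a false ++ replicate b true) ≡ 0
coinv-sorted (suc a) b       = coinv-sorted a b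
coinv-sorted zero    zero    = refl
coinv-sorted zero    (suc b) = trans (cong (ℕ._+ coinv (replicate b true)) (no-minus b)) (coinv-sorted zero b)
  where
  no-minus : ∀ b → countMinus (replicate b true) ≡ 0
  no-minus zero    = refl
  no-minus (suc b) = no-minus b

signℤ : ℕ → ℤ
signℤ zero          = ℤ.+ 1
signℤ (suc zero)    = ℤ.-[1+ 0 ]
signℤ (suc (suc c)) = signℤ c

-- (-v)^c / v as a list of coefficients, for c ≥ 1.
shiftedPower : ℕ → List ℤ
shiftedPower zero    = []
shiftedPower (suc c) = replicate c (ℤ.+ 0) ++ signℤ (suc c) ∷ []

signℤ-value : ∀ c → signℤ c ℚ./ 1 ≡ (- 1ℚ) ^ c
signℤ-value zero          = refl
signℤ-value (suc zero)    = refl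
signℤ-value (suc (suc c)) = trans (signℤ-value c) (ring ((- 1ℚ) ^ c))
  where
  ring : ∀ x → x ≡ - 1ℚ * (- 1ℚ * x)
  ring = solve-∀ ℚ-ring

-- The Hecke action at v = q

module AtPoint (q : ℚ) (q≢0 : q ≢ 0ℚ) where

  open ≡-Reasoning

  p : ℚ
  p = inv q

  -- The transposed action: pairT y x s o is the coefficient of a word with
  -- letters y x at positions i, i+1 in T_i m, where s and o are the
  -- coefficients in m of that word with those two letters swapped and not.
  pairT : Bool → Bool → ℚ → ℚ → ℚ
  pairT true  false s o = s
  pairT false true  s o = s + (q - p) * o
  pairT true  true  s o = - p * o
  pairT false false s o = - p * o

  coeffT : ℕ → Coeffs → Coeffs
  coeffT (suc zero)    g (y ∷ x ∷ ε) = pairT y x (g (x ∷ y ∷ ε)) (g (y ∷ x ∷ ε))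
  coeffT (suc (suc i)) g (a ∷ ε)     = coeffT (suc i) (λ δ → g (a ∷ δ)) ε
  coeffT _             g ε           = g ε

  pairT-scale : ∀ y x c s o → pairT y x (c * s) (c * o) ≡ c * pairT y x s o
  pairT-scale true  false c s o = refl
  pairT-scale false true  c s o = ring c s o (q - p)
    where
    ring : ∀ c s o d → c * s + d * (c * o) ≡ c * (s + d * o)
    ring = solve-∀ ℚ-ring
  pairT-scale true  true  c s o = x∙yz≡y∙xz (- p) c o
  pairT-scale false false c s o = x∙yz≡y∙xz (- p) c o

  pairT-+ : ∀ y x s o s' o' → pairT y x (s + s') (o + o') ≡ pairT y x s o + pairT y x s' o'
  pairT-+ true  false s o s' o' = refl
  pairT-+ false true  s o s' o' = ring s o s' o' (q - p)
    where
    ring : ∀ s o s' o' d → (s + s') + d * (o + o') ≡ (s + d * o) + (s' + d * o')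
    ring = solve-∀ ℚ-ring
  pairT-+ true  true  s o s' o' = ℚ.*-distribˡ-+ (- p) o o'
  pairT-+ false false s o s' o' = ℚ.*-distribˡ-+ (- p) o o'

  pairT-0 : ∀ y x → pairT y x 0ℚ 0ℚ ≡ 0ℚ
  pairT-0 y x = trans (pairT-scale y x 0ℚ 0ℚ 0ℚ) (ℚ.*-zeroˡ (pairT y x 0ℚ 0ℚ))

  coeffT-local : ∀ i → Local (coeffT i)
  coeffT-local (suc zero)    f≗g (y ∷ x ∷ ε) |ε| = cong₂ (pairT y x) (f≗g (x ∷ y ∷ ε) |ε|) (f≗g (y ∷ x ∷ ε) |ε|)
  coeffT-local (suc (suc i)) f≗g (a ∷ ε)     refl =
    coeffT-local (suc i) (λ δ |δ| → f≗g (a ∷ δ) (cong suc |δ|)) ε refl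
  coeffT-local zero          f≗g ε           |ε| = f≗g ε |ε|
  coeffT-local (suc zero)    f≗g []          |ε| = f≗g [] |ε|
  coeffT-local (suc zero)    f≗g (y ∷ [])    |ε| = f≗g (y ∷ []) |ε|
  coeffT-local (suc (suc i)) f≗g []          |ε| = f≗g [] |ε|

  coeffT-homogeneous : ∀ i → Homogeneous (coeffT i)
  coeffT-homogeneous (suc zero)    c g (y ∷ x ∷ ε) = pairT-scale y x c _ _
  coeffT-homogeneous (suc (suc i)) c g (a ∷ ε)     = coeffT-homogeneous (suc i) c (λ δ → g (a ∷ δ)) ε
  coeffT-homogeneous zero          c g ε           = refl
  coeffT-homogeneous (suc zero)    c g []          = refl
  coeffT-homogeneous (suc zero)    c g (y ∷ [])    = refl
  coeffT-homogeneous (suc (suc i)) c g []          = refl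

  coeffT-+ : ∀ i f g ε → coeffT i (λ δ → f δ + g δ) ε ≡ coeffT i f ε + coeffT i g ε
  coeffT-+ (suc zero)    f g (y ∷ x ∷ ε) = pairT-+ y x _ _ _ _
  coeffT-+ (suc (suc i)) f g (a ∷ ε)     = coeffT-+ (suc i) (λ δ → f (a ∷ δ)) (λ δ → g (a ∷ δ)) ε
  coeffT-+ zero          f g ε           = refl
  coeffT-+ (suc zero)    f g []          = refl
  coeffT-+ (suc zero)    f g (y ∷ [])    = refl
  coeffT-+ (suc (suc i)) f g []          = refl

  coeffT-0 : ∀ i ε → coeffT i (λ _ → 0ℚ) ε ≡ 0ℚ
  coeffT-0 (suc zero)    (y ∷ x ∷ ε) = pairT-0 y x
  coeffT-0 (suc (suc i)) (a ∷ ε)     = coeffT-0 (suc i) ε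
  coeffT-0 zero          ε           = refl
  coeffT-0 (suc zero)    []          = refl
  coeffT-0 (suc zero)    (y ∷ [])    = refl
  coeffT-0 (suc (suc i)) []          = refl

  coeffT-∣last : ∀ i g x ε → suc i ≤ length ε → (coeffT i g ∣last x) ε ≡ coeffT i (g ∣last x) ε
  coeffT-∣last zero          g x ε           _         = refl
  coeffT-∣last (suc zero)    g x (y ∷ w ∷ ε) _         = refl
  coeffT-∣last (suc zero)    g x (y ∷ [])    (s≤s ())
  coeffT-∣last (suc (suc i)) g x (a ∷ ε)     (s≤s i<ε) = coeffT-∣last (suc i) (λ δ → g (a ∷ δ)) x ε i<ε

  coeffT-at : ∀ g ε y x ε' →
    coeffT (suc (length ε)) g (ε ++ y ∷ x ∷ ε') ≡ pairT y x (g (ε ++ x ∷ y ∷ ε')) (g (ε ++ y ∷ x ∷ ε'))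
  coeffT-at g []      y x ε' = refl
  coeffT-at g (a ∷ ε) y x ε' = coeffT-at (λ δ → g (a ∷ δ)) ε y x ε'

  coeffsAt : M → Coeffs
  coeffsAt []            ε = 0ℚ
  coeffsAt ((c , δ) ∷ m) ε = single δ (evalF q c) ε + coeffsAt m ε

  Defined : M → Set
  Defined = All (λ cδ → denAt (proj₁ cδ) q ≢ 0ℚ)

  coeffM-↦ : ∀ m ε → Defined m → coeffM m ε ↦[ q ] coeffsAt m ε
  coeffM-↦ []            ε []        = ↦-constF 0ℚ q
  coeffM-↦ ((c , δ) ∷ m) ε (c≢0 ∷ m≢0) with List.≡-dec Bool._≟_ δ ε
  ... | yes _ = ↦-+F (↦-evalF c c≢0) (coeffM-↦ m ε m≢0)
  ... | no  _ = subst (coeffM m ε ↦[ q ]_) (sym (ℚ.+-identityˡ _)) (coeffM-↦ m ε m≢0)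

  evalF-*F : ∀ c d → denAt c q ≢ 0ℚ → denAt d q ≢ 0ℚ → evalF q (c *F d) ≡ evalF q c * evalF q d
  evalF-*F c d c≢0 d≢0 = ↦⇒evalF≡ (↦-*F (↦-evalF c c≢0) (↦-evalF d d≢0))

  coeffsAt-++ : ∀ m m' ε → coeffsAt (m ++ m') ε ≡ coeffsAt m ε + coeffsAt m' ε
  coeffsAt-++ []            m' ε = sym (ℚ.+-identityˡ _)
  coeffsAt-++ ((c , δ) ∷ m) m' ε =
    trans (cong (single δ (evalF q c) ε +_) (coeffsAt-++ m m' ε)) (sym (ℚ.+-assoc (single δ (evalF q c) ε) _ _))

  Defined-++ : ∀ {m m'} → Defined m → Defined m' → Defined (m ++ m')
  Defined-++ []          m'≢0 = m'≢0
  Defined-++ (c≢0 ∷ m≢0) m'≢0 = c≢0 ∷ Defined-++ m≢0 m'≢0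

  coeffsAt-*sM : ∀ c m ε → denAt c q ≢ 0ℚ → Defined m → coeffsAt (c *sM m) ε ≡ evalF q c * coeffsAt m ε
  coeffsAt-*sM c []            ε c≢0 []          = sym (ℚ.*-zeroʳ (evalF q c))
  coeffsAt-*sM c ((d , δ) ∷ m) ε c≢0 (d≢0 ∷ m≢0) = begin
    single δ (evalF q (c *F d)) ε + coeffsAt (c *sM m) ε
      ≡⟨ cong₂ _+_ (trans (cong (λ x → single δ x ε) (evalF-*F c d c≢0 d≢0)) (single-scale δ _ ε)) (coeffsAt-*sM c m ε c≢0 m≢0) ⟩
    (γ * evalF q d) * single δ 1ℚ ε + γ * coeffsAt m ε
      ≡⟨ cong (_+ γ * coeffsAt m ε) (trans (ℚ.*-assoc γ (evalF q d) _) (cong (γ *_) (sym (single-scale δ _ ε)))) ⟩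
    γ * single δ (evalF q d) ε + γ * coeffsAt m ε
      ≡⟨ ℚ.*-distribˡ-+ γ _ _ ⟨
    γ * (single δ (evalF q d) ε + coeffsAt m ε) ∎
    where
    γ = evalF q c

  Defined-*sM : ∀ c m → denAt c q ≢ 0ℚ → Defined m → Defined (c *sM m)
  Defined-*sM c []            c≢0 []          = []
  Defined-*sM c ((d , δ) ∷ m) c≢0 (d≢0 ∷ m≢0) =
    _↦[_]_.den≢0 (↦-*F (↦-evalF c c≢0) (↦-evalF d d≢0)) ∷ Defined-*sM c m c≢0 m≢0

  1F↦1 : 1F ↦[ q ] 1ℚ
  1F↦1 = ↦-constF 1ℚ q

  -1F↦-1 : (-F 1F) ↦[ q ] - 1ℚ
  -1F↦-1 = ↦-negF 1F↦1

  -v⁻¹F↦-p : (-F v⁻¹F) ↦[ q ] - p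
  -v⁻¹F↦-p = ↦-negF (↦-v⁻¹F q≢0)

  v-v⁻¹F↦q-p : (vF -F v⁻¹F) ↦[ q ] q - p
  v-v⁻¹F↦q-p = ↦-+F (↦-vF q) -v⁻¹F↦-p

  T₁single : Bool → Bool → Seq → Coeffs
  T₁single true  false δ ε = single (false ∷ true ∷ δ) 1ℚ ε
  T₁single false true  δ ε = single (true ∷ false ∷ δ) 1ℚ ε + (q - p) * single (false ∷ true ∷ δ) 1ℚ ε
  T₁single true  true  δ ε = - p * single (true ∷ true ∷ δ) 1ℚ ε
  T₁single false false δ ε = - p * single (false ∷ false ∷ δ) 1ℚ ε

  Defined-Tbasis : ∀ i δ → Defined (Tbasis i δ)
  Defined-Tbasis (suc zero)    (true  ∷ false ∷ δ) = _↦[_]_.den≢0 1F↦1 ∷ []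
  Defined-Tbasis (suc zero)    (false ∷ true  ∷ δ) = _↦[_]_.den≢0 1F↦1 ∷ _↦[_]_.den≢0 v-v⁻¹F↦q-p ∷ []
  Defined-Tbasis (suc zero)    (true  ∷ true  ∷ δ) = _↦[_]_.den≢0 -v⁻¹F↦-p ∷ []
  Defined-Tbasis (suc zero)    (false ∷ false ∷ δ) = _↦[_]_.den≢0 -v⁻¹F↦-p ∷ []
  Defined-Tbasis (suc (suc i)) (a ∷ δ)             = All.map⁺ (Defined-Tbasis (suc i) δ)
  Defined-Tbasis zero          δ                   = _↦[_]_.den≢0 1F↦1 ∷ []
  Defined-Tbasis (suc zero)    []                  = _↦[_]_.den≢0 1F↦1 ∷ []
  Defined-Tbasis (suc zero)    (true ∷ [])         = _↦[_]_.den≢0 1F↦1 ∷ []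
  Defined-Tbasis (suc zero)    (false ∷ [])        = _↦[_]_.den≢0 1F↦1 ∷ []
  Defined-Tbasis (suc (suc i)) []                  = _↦[_]_.den≢0 1F↦1 ∷ []

  coeffsAt-singleton : ∀ {c a} δ ε → c ↦[ q ] a → coeffsAt ((c , δ) ∷ []) ε ≡ a * single δ 1ℚ ε
  coeffsAt-singleton δ ε c↦a =
    trans (ℚ.+-identityʳ _) (trans (cong (λ x → single δ x ε) (↦⇒evalF≡ c↦a)) (single-scale δ _ ε))

  coeffsAt-basis : ∀ δ ε → coeffsAt (basis δ) ε ≡ single δ 1ℚ ε
  coeffsAt-basis δ ε = trans (coeffsAt-singleton δ ε 1F↦1) (ℚ.*-identityˡ _)

  coeffsAt-Tbasis₁ : ∀ u v δ ε → coeffsAt (Tbasis 1 (u ∷ v ∷ δ)) ε ≡ T₁single u v δ ε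
  coeffsAt-Tbasis₁ true  false δ ε = coeffsAt-basis (false ∷ true ∷ δ) ε
  coeffsAt-Tbasis₁ false true  δ ε = cong₂ _+_
    (cong (λ x → single (true ∷ false ∷ δ) x ε) (↦⇒evalF≡ 1F↦1))
    (coeffsAt-singleton (false ∷ true ∷ δ) ε v-v⁻¹F↦q-p)
  coeffsAt-Tbasis₁ true  true  δ ε = coeffsAt-singleton (true ∷ true ∷ δ) ε -v⁻¹F↦-p
  coeffsAt-Tbasis₁ false false δ ε = coeffsAt-singleton (false ∷ false ∷ δ) ε -v⁻¹F↦-p

  coeffT₁-single : ∀ u v δ y z ε →
    pairT y z (single (u ∷ v ∷ δ) 1ℚ (z ∷ y ∷ ε)) (single (u ∷ v ∷ δ) 1ℚ (y ∷ z ∷ ε)) ≡ T₁single u v δ (y ∷ z ∷ ε)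
  coeffT₁-single true  false δ true  false ε = refl
  coeffT₁-single true  false δ false true  ε = a+d*0≡a _ (q - p)
  coeffT₁-single true  false δ true  true  ε = ℚ.*-zeroʳ (- p)
  coeffT₁-single true  false δ false false ε = ℚ.*-zeroʳ (- p)
  coeffT₁-single false true  δ true  false ε = sym (a+d*0≡a _ (q - p))
  coeffT₁-single false true  δ false true  ε = refl
  coeffT₁-single false true  δ true  true  ε = d*0≡0+e*0 (- p) (q - p)
  coeffT₁-single false true  δ false false ε = d*0≡0+e*0 (- p) (q - p)
  coeffT₁-single true  true  δ true  false ε = sym (ℚ.*-zeroʳ (- p))
  coeffT₁-single true  true  δ false true  ε = sym (d*0≡0+e*0 (- p) (q - p))
  coeffT₁-single true  true  δ true  true  ε = refl
  coeffT₁-single true  true  δ false false ε = refl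
  coeffT₁-single false false δ true  false ε = sym (ℚ.*-zeroʳ (- p))
  coeffT₁-single false false δ false true  ε = sym (d*0≡0+e*0 (- p) (q - p))
  coeffT₁-single false false δ true  true  ε = refl
  coeffT₁-single false false δ false false ε = refl

  T₁single-≢length : ∀ u v δ ε → length ε ≢ 2 ℕ.+ length δ → T₁single u v δ ε ≡ 0ℚ
  T₁single-≢length u v δ ε ε≢ = helper u v
    where
    zero-at : ∀ a b → single (a ∷ b ∷ δ) 1ℚ ε ≡ 0ℚ
    zero-at a b = single-≢length (a ∷ b ∷ δ) 1ℚ ε (λ eq → ε≢ (sym eq))
    helper : ∀ u v → T₁single u v δ ε ≡ 0ℚ
    helper true  false = zero-at false true
    helper false true  = trans (cong₂ (λ s o → s + (q - p) * o) (zero-at true false) (zero-at false true))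
                               (sym (d*0≡0+e*0 0ℚ (q - p)))
    helper true  true  = trans (cong (- p *_) (zero-at true true)) (ℚ.*-zeroʳ (- p))
    helper false false = trans (cong (- p *_) (zero-at false false)) (ℚ.*-zeroʳ (- p))

  module _ (a : Bool) (f : RF × Seq → RF × Seq) (f≡ : ∀ c δ → f (c , δ) ≡ (c , a ∷ δ)) where

    coeffsAt-map-[] : ∀ m → coeffsAt (map f m) [] ≡ 0ℚ
    coeffsAt-map-[] []            = refl
    coeffsAt-map-[] ((c , δ) ∷ m) rewrite f≡ c δ = trans (ℚ.+-identityˡ _) (coeffsAt-map-[] m)

    coeffsAt-map-∷ : ∀ m b ε → coeffsAt (map f m) (b ∷ ε) ≡ (if does (a Bool.≟ b) then coeffsAt m ε else 0ℚ)
    coeffsAt-map-∷ []            b ε = helper a b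
      where
      helper : ∀ a b → 0ℚ ≡ (if does (a Bool.≟ b) then 0ℚ else 0ℚ)
      helper true  true  = refl
      helper true  false = refl
      helper false true  = refl
      helper false false = refl
    coeffsAt-map-∷ ((c , δ) ∷ m) b ε rewrite f≡ c δ = helper a b (coeffsAt-map-∷ m b ε)
      where
      helper : ∀ a b → coeffsAt (map f m) (b ∷ ε) ≡ (if does (a Bool.≟ b) then coeffsAt m ε else 0ℚ) →
               single (a ∷ δ) (evalF q c) (b ∷ ε) + coeffsAt (map f m) (b ∷ ε)
                 ≡ (if does (a Bool.≟ b) then single δ (evalF q c) ε + coeffsAt m ε else 0ℚ)
      helper true  true  ih = cong (single δ (evalF q c) ε +_) ih
      helper true  false ih = trans (ℚ.+-identityˡ _) ih
      helper false true  ih = trans (ℚ.+-identityˡ _) ih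
      helper false false ih = cong (single δ (evalF q c) ε +_) ih

  coeffT₁-short : ∀ δ ε → length δ ≤ 1 → coeffT 1 (single δ 1ℚ) ε ≡ single δ 1ℚ ε
  coeffT₁-short δ []          _   = refl
  coeffT₁-short δ (y ∷ [])    _   = refl
  coeffT₁-short δ (y ∷ z ∷ ε) δ≤1 = begin
    pairT y z (single δ 1ℚ (z ∷ y ∷ ε)) (single δ 1ℚ (y ∷ z ∷ ε))  ≡⟨ cong₂ (pairT y z) (too-short z y ε) (too-short y z ε) ⟩
    pairT y z 0ℚ 0ℚ                                                ≡⟨ pairT-0 y z ⟩
    0ℚ                                                             ≡⟨ too-short y z ε ⟨
    single δ 1ℚ (y ∷ z ∷ ε)                                        ∎
    where
    too-short : ∀ y z ε → single δ 1ℚ (y ∷ z ∷ ε) ≡ 0ℚ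
    too-short y z ε = single-≢length δ 1ℚ _ (λ eq → ℕ.<-irrefl refl (ℕ.≤-trans (s≤s (s≤s z≤n)) (subst (_≤ 1) eq δ≤1)))

  coeffT-single : ∀ i δ ε → coeffT i (single δ 1ℚ) ε ≡ coeffsAt (Tbasis i δ) ε
  coeffT-single zero          δ           ε           = sym (coeffsAt-basis δ ε)
  coeffT-single (suc zero)    []          ε           = trans (coeffT₁-short [] ε z≤n) (sym (coeffsAt-basis [] ε))
  coeffT-single (suc zero)    (true ∷ []) ε           = trans (coeffT₁-short (true ∷ []) ε ℕ.≤-refl) (sym (coeffsAt-basis (true ∷ []) ε))
  coeffT-single (suc zero)    (false ∷ []) ε          = trans (coeffT₁-short (false ∷ []) ε ℕ.≤-refl) (sym (coeffsAt-basis (false ∷ []) ε))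
  coeffT-single (suc zero)    (u ∷ v ∷ δ) (y ∷ z ∷ ε) = trans (coeffT₁-single u v δ y z ε) (sym (coeffsAt-Tbasis₁ u v δ _))
  coeffT-single (suc zero)    (u ∷ v ∷ δ) ε@[]        =
    trans (single-≢length (u ∷ v ∷ δ) 1ℚ ε (λ ())) (sym (trans (coeffsAt-Tbasis₁ u v δ ε) (T₁single-≢length u v δ ε (λ ()))))
  coeffT-single (suc zero)    (u ∷ v ∷ δ) ε@(_ ∷ [])  =
    trans (single-≢length (u ∷ v ∷ δ) 1ℚ ε (λ ())) (sym (trans (coeffsAt-Tbasis₁ u v δ ε) (T₁single-≢length u v δ ε (λ ()))))
  coeffT-single (suc (suc i)) []          []          = sym (coeffsAt-basis [] [])
  coeffT-single (suc (suc i)) []          (b ∷ ε)     = trans (coeffT-0 (suc i) ε) (sym (coeffsAt-basis [] (b ∷ ε)))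
  coeffT-single (suc (suc i)) (a ∷ δ)     []          = sym (coeffsAt-map-[] a _ (λ c δ → refl) (Tbasis (suc i) δ))
  coeffT-single (suc (suc i)) (a ∷ δ)     (b ∷ ε)     =
    trans (helper a b) (sym (coeffsAt-map-∷ a _ (λ c δ → refl) (Tbasis (suc i) δ) b ε))
    where
    helper : ∀ a b → coeffT (suc i) (λ e → single (a ∷ δ) 1ℚ (b ∷ e)) ε
                       ≡ (if does (a Bool.≟ b) then coeffsAt (Tbasis (suc i) δ) ε else 0ℚ)
    helper true  true  = coeffT-single (suc i) δ ε
    helper true  false = coeffT-0 (suc i) ε
    helper false true  = coeffT-0 (suc i) ε
    helper false false = coeffT-single (suc i) δ ε

  coeffT-singleAt : ∀ i δ x ε → coeffT i (single δ x) ε ≡ x * coeffsAt (Tbasis i δ) ε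
  coeffT-singleAt i δ x ε = begin
    coeffT i (single δ x) ε                  ≡⟨ coeffT-local i (λ e _ → single-scale δ x e) ε refl ⟩
    coeffT i (λ e → x * single δ 1ℚ e) ε     ≡⟨ coeffT-homogeneous i x (single δ 1ℚ) ε ⟩
    x * coeffT i (single δ 1ℚ) ε             ≡⟨ cong (x *_) (coeffT-single i δ ε) ⟩
    x * coeffsAt (Tbasis i δ) ε              ∎

  Defined-actT : ∀ i m → Defined m → Defined (actT i m)
  Defined-actT i []            []          = []
  Defined-actT i ((c , δ) ∷ m) (c≢0 ∷ m≢0) =
    Defined-++ (Defined-*sM c (Tbasis i δ) c≢0 (Defined-Tbasis i δ)) (Defined-actT i m m≢0)

  coeffsAt-actT : ∀ i m → Defined m → ∀ ε → coeffsAt (actT i m) ε ≡ coeffT i (coeffsAt m) ε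
  coeffsAt-actT i []            []          ε = sym (coeffT-0 i ε)
  coeffsAt-actT i ((c , δ) ∷ m) (c≢0 ∷ m≢0) ε = begin
    coeffsAt (c *sM Tbasis i δ ++ actT i m) ε
      ≡⟨ coeffsAt-++ (c *sM Tbasis i δ) (actT i m) ε ⟩
    coeffsAt (c *sM Tbasis i δ) ε + coeffsAt (actT i m) ε
      ≡⟨ cong₂ _+_ (coeffsAt-*sM c (Tbasis i δ) ε c≢0 (Defined-Tbasis i δ)) (coeffsAt-actT i m m≢0 ε) ⟩
    evalF q c * coeffsAt (Tbasis i δ) ε + coeffT i (coeffsAt m) ε
      ≡⟨ cong (_+ coeffT i (coeffsAt m) ε) (coeffT-singleAt i δ (evalF q c) ε) ⟨
    coeffT i (single δ (evalF q c)) ε + coeffT i (coeffsAt m) ε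
      ≡⟨ coeffT-+ i (single δ (evalF q c)) (coeffsAt m) ε ⟨
    coeffT i (coeffsAt ((c , δ) ∷ m)) ε ∎

  -- T_i⁻¹ = T_i - (v - v⁻¹) by the quadratic relation.
  coeffH : H → Coeffs → Coeffs
  coeffH (T i)    g   = coeffT i g
  coeffH (Tinv i) g ε = coeffT i g ε - (q - p) * g ε
  coeffH (sc c)   g ε = evalF q c * g ε
  coeffH (h ⊕ h') g ε = coeffH h g ε + coeffH h' g ε
  coeffH (h ⊗ h') g   = coeffH h (coeffH h' g)

  DefinedH : H → Set
  DefinedH (T i)    = ⊤
  DefinedH (Tinv i) = ⊤
  DefinedH (sc c)   = denAt c q ≢ 0ℚ
  DefinedH (h ⊕ h') = DefinedH h × DefinedH h'
  DefinedH (h ⊗ h') = DefinedH h × DefinedH h'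

  coeffH-local : ∀ h → Local (coeffH h)
  coeffH-local (T i)    f≗g         = coeffT-local i f≗g
  coeffH-local (Tinv i) f≗g ε |ε| = cong₂ (λ u w → u - (q - p) * w) (coeffT-local i f≗g ε |ε|) (f≗g ε |ε|)
  coeffH-local (sc c)   f≗g ε |ε| = cong (evalF q c *_) (f≗g ε |ε|)
  coeffH-local (h ⊕ h') f≗g ε |ε| = cong₂ _+_ (coeffH-local h f≗g ε |ε|) (coeffH-local h' f≗g ε |ε|)
  coeffH-local (h ⊗ h') f≗g         = coeffH-local h (coeffH-local h' f≗g)

  actH-coeffsAt : ∀ h m → DefinedH h → Defined m →
                  Defined (actH h m) × (∀ ε → coeffsAt (actH h m) ε ≡ coeffH h (coeffsAt m) ε)
  actH-coeffsAt (T i)    m _ m≢0 = Defined-actT i m m≢0 , coeffsAt-actT i m m≢0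
  actH-coeffsAt (Tinv i) m _ m≢0 =
    Defined-++ (Defined-actT i m m≢0) (Defined-*sM (-F 1F) _ -1≢0 (Defined-*sM (vF -F v⁻¹F) m v-v⁻¹≢0 m≢0)) ,
    λ ε → begin
      coeffsAt (actT i m ++ (-F 1F) *sM ((vF -F v⁻¹F) *sM m)) ε
        ≡⟨ coeffsAt-++ (actT i m) _ ε ⟩
      coeffsAt (actT i m) ε + coeffsAt ((-F 1F) *sM ((vF -F v⁻¹F) *sM m)) ε
        ≡⟨ cong₂ _+_ (coeffsAt-actT i m m≢0 ε)
                     (trans (coeffsAt-*sM (-F 1F) _ ε -1≢0 (Defined-*sM (vF -F v⁻¹F) m v-v⁻¹≢0 m≢0))
                            (cong (evalF q (-F 1F) *_) (coeffsAt-*sM (vF -F v⁻¹F) m ε v-v⁻¹≢0 m≢0))) ⟩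
      coeffT i (coeffsAt m) ε + evalF q (-F 1F) * (evalF q (vF -F v⁻¹F) * coeffsAt m ε)
        ≡⟨ cong₂ (λ a b → coeffT i (coeffsAt m) ε + a * (b * coeffsAt m ε)) (↦⇒evalF≡ -1F↦-1) (↦⇒evalF≡ v-v⁻¹F↦q-p) ⟩
      coeffT i (coeffsAt m) ε + - 1ℚ * ((q - p) * coeffsAt m ε)
        ≡⟨ x+-1*y≡x-y (coeffT i (coeffsAt m) ε) ((q - p) * coeffsAt m ε) ⟩
      coeffT i (coeffsAt m) ε - (q - p) * coeffsAt m ε ∎
    where
    -1≢0 : denAt (-F 1F) q ≢ 0ℚ
    -1≢0 = _↦[_]_.den≢0 -1F↦-1
    v-v⁻¹≢0 : denAt (vF -F v⁻¹F) q ≢ 0ℚ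
    v-v⁻¹≢0 = _↦[_]_.den≢0 v-v⁻¹F↦q-p
  actH-coeffsAt (sc c)   m c≢0 m≢0 = Defined-*sM c m c≢0 m≢0 , λ ε → coeffsAt-*sM c m ε c≢0 m≢0
  actH-coeffsAt (h ⊕ h') m (h≢0 , h'≢0) m≢0 =
    Defined-++ (proj₁ ih) (proj₁ ih') , λ ε → trans (coeffsAt-++ (actH h m) (actH h' m) ε) (cong₂ _+_ (proj₂ ih ε) (proj₂ ih' ε))
    where
    ih  = actH-coeffsAt h  m h≢0  m≢0
    ih' = actH-coeffsAt h' m h'≢0 m≢0
  actH-coeffsAt (h ⊗ h') m (h≢0 , h'≢0) m≢0 =
    proj₁ ih , λ ε → trans (proj₂ ih ε) (coeffH-local h (λ δ _ → proj₂ ih' δ) ε refl)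
    where
    ih' = actH-coeffsAt h' m h'≢0 m≢0
    ih  = actH-coeffsAt h (actH h' m) h≢0 (proj₁ ih')

  BarInvariant : H → Set
  BarInvariant h = ∀ g ε → coeffH (barH h) g ε ≡ coeffH h g ε

  prodH-downFrom : ∀ (P : H → Set) → P (sc 1F) → (∀ h h' → P h → P h' → P (h ⊗ h')) →
                   ∀ (f : ℕ → H) j → (∀ t → t < j → P (f (suc t))) → P (prodH (map f (downFrom j)))
  prodH-downFrom P P1 P⊗ f zero    Pf = P1
  prodH-downFrom P P1 P⊗ f (suc j) Pf = P⊗ _ _ (Pf j ℕ.≤-refl) (prodH-downFrom P P1 P⊗ f j (λ t t<j → Pf t (ℕ.m<n⇒m<1+n t<j)))

  DefinedH-⊗ : ∀ h h' → DefinedH h → DefinedH h' → DefinedH (h ⊗ h')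
  DefinedH-⊗ h h' = _,_

  BarInvariant-⊗ : ∀ h h' → BarInvariant h → BarInvariant h' → BarInvariant (h ⊗ h')
  BarInvariant-⊗ h h' bar-h bar-h' g ε =
    trans (coeffH-local (barH h) (λ δ _ → bar-h' g δ) ε refl) (bar-h (coeffH h' g) ε)

  1F-defined : DefinedH (sc 1F)
  1F-defined = _↦[_]_.den≢0 1F↦1

  E′ : ℚ → ℚ
  E′ x = x * x - 1ℚ

  -- At v = q, v^r/[r] = N r / (q · E r).
  E N : ℕ → ℚ
  E r = E′ (q ^ r)
  N r = q ^ r * q ^ r * (q * q - 1ℚ)

  E+N≡E : ∀ r → E r + N r ≡ E (suc r)
  E+N≡E r = ring q (q ^ r)
    where
    ring : ∀ q x → (x * x - 1ℚ) + x * x * (q * q - 1ℚ) ≡ (q * x) * (q * x) - 1ℚ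
    ring = solve-∀ ℚ-ring

  κ : ℕ → ℚ
  κ r = q * evalF q (ratio r)

  -- q (T_i - v^r/[r]); the factor q keeps all coefficients below polynomial in q.
  F : ℕ → ℕ → Coeffs → Coeffs
  F i r g ε = q * coeffT i g ε - κ r * g ε

  F-local : ∀ i r → Local (F i r)
  F-local i r f≗g ε |ε| = cong₂ (λ u w → q * u - κ r * w) (coeffT-local i f≗g ε |ε|) (f≗g ε |ε|)

  F-homogeneous : ∀ i r → Homogeneous (F i r)
  F-homogeneous i r c g ε = trans (cong (λ u → q * u - κ r * (c * g ε)) (coeffT-homogeneous i c g ε))
                                  (ring q (κ r) c (coeffT i g ε) (g ε))
    where
    ring : ∀ q k c t x → q * (c * t) - k * (c * x) ≡ c * (q * t - k * x)
    ring = solve-∀ ℚ-ring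

  F-∣last : ∀ i r g x ε → suc i ≤ length ε → (F i r g ∣last x) ε ≡ F i r (g ∣last x) ε
  F-∣last i r g x ε i<ε = cong (λ u → q * u - κ r * g (ε ++ x ∷ [])) (coeffT-∣last i g x ε i<ε)

  F-prefixPlus : ∀ a j r g ε → F (suc (a ℕ.+ j)) r (prefixPlus a g) ε ≡ prefixPlus a (F (suc j) r g) ε
  F-prefixPlus zero    j r g ε           = refl
  F-prefixPlus (suc a) j r g (true ∷ ε)  = F-prefixPlus a j r g ε
  F-prefixPlus (suc a) j r g (false ∷ ε) =
    trans (cong (λ u → q * u - κ r * 0ℚ) (coeffT-0 (suc (a ℕ.+ j)) ε)) (q*0-k*0≡0 q (κ r))
  F-prefixPlus (suc a) j r g []          = q*0-k*0≡0 q (κ r)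

  -- One row of X_λ: the factors at positions s+L, …, s+1 with shifts K+1, …, K+L.
  Row : ℕ → ℕ → ℕ → Coeffs → Coeffs
  Row s K zero    g = g
  Row s K (suc L) g = F (suc (s ℕ.+ L)) (suc K) (Row s (suc K) L g)

  Row-local : ∀ s K L → Local (Row s K L)
  Row-local s K zero    f≗g = f≗g
  Row-local s K (suc L) f≗g = F-local (suc (s ℕ.+ L)) (suc K) (Row-local s (suc K) L f≗g)

  Row-homogeneous : ∀ s K L → Homogeneous (Row s K L)
  Row-homogeneous s K zero    c g ε = refl
  Row-homogeneous s K (suc L) c g ε =
    trans (F-local (suc (s ℕ.+ L)) (suc K) (λ δ _ → Row-homogeneous s (suc K) L c g δ) ε refl)
          (F-homogeneous (suc (s ℕ.+ L)) (suc K) c (Row s (suc K) L g) ε)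

  Row-∣last : ∀ s K L g x {N} → suc (s ℕ.+ L) ≤ N → (Row s K L g ∣last x) ≗[ N ] Row s K L (g ∣last x)
  Row-∣last s K zero    g x _     ε |ε| = refl
  Row-∣last s K (suc L) g x {N} s+L<N ε |ε| =
    trans (F-∣last (suc (s ℕ.+ L)) (suc K) (Row s (suc K) L g) x ε (subst (suc (suc (s ℕ.+ L)) ≤_) (sym |ε|) s+L+1<N))
          (F-local (suc (s ℕ.+ L)) (suc K) (Row-∣last s (suc K) L g x (ℕ.<⇒≤ s+L+1<N)) ε |ε|)
    where
    s+L+1<N : suc (suc (s ℕ.+ L)) ≤ N
    s+L+1<N = subst (λ n → suc n ≤ N) (ℕ.+-suc s L) s+L<N

  Row-prefixPlus : ∀ a K L g ε → Row a K L (prefixPlus a g) ε ≡ prefixPlus a (Row 0 K L g) ε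
  Row-prefixPlus a K zero    g ε = refl
  Row-prefixPlus a K (suc L) g ε =
    trans (F-local (suc (a ℕ.+ L)) (suc K) (λ δ _ → Row-prefixPlus a (suc K) L g δ) ε refl)
          (F-prefixPlus a L (suc K) (Row 0 (suc K) L g) ε)

  -- The rows t, …, t + a - 1 of a rectangle of width L; row t + a - 1 is applied first.
  RowsFrom : ℕ → ℕ → ℕ → Coeffs → Coeffs
  RowsFrom t zero    L g = g
  RowsFrom t (suc a) L g = RowsFrom t a L (Row (t ℕ.+ a) (t ℕ.+ a) L g)

  Rows : ℕ → ℕ → Coeffs → Coeffs
  Rows = RowsFrom 0

  RowsFrom-local : ∀ t a L → Local (RowsFrom t a L)
  RowsFrom-local t zero    L f≗g = f≗g
  RowsFrom-local t (suc a) L f≗g = RowsFrom-local t a L (Row-local (t ℕ.+ a) (t ℕ.+ a) L f≗g)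

  RowsFrom-suc : ∀ t a L g ε → RowsFrom t (suc a) L g ε ≡ Row t t L (RowsFrom (suc t) a L g) ε
  RowsFrom-suc t zero    L g ε = cong (λ s → Row s s L g ε) (ℕ.+-identityʳ t)
  RowsFrom-suc t (suc a) L g ε =
    trans (RowsFrom-suc t a L (Row (t ℕ.+ suc a) (t ℕ.+ suc a) L g) ε)
          (Row-local t t L (λ δ _ → cong (λ s → RowsFrom (suc t) a L (Row s s L g) δ) (ℕ.+-suc t a)) ε refl)

  Rows-homogeneous : ∀ a L → Homogeneous (Rows a L)
  Rows-homogeneous zero    L c g ε = refl
  Rows-homogeneous (suc a) L c g ε =
    trans (RowsFrom-local 0 a L (λ δ _ → Row-homogeneous a a L c g δ) ε refl) (Rows-homogeneous a L c (Row a a L g) ε)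

  Rows-∣last : ∀ a L g x {N} → a ℕ.+ L ≤ N → (Rows a L g ∣last x) ≗[ N ] Rows a L (g ∣last x)
  Rows-∣last zero    L g x _       ε |ε| = refl
  Rows-∣last (suc a) L g x a+L<N ε |ε| =
    trans (Rows-∣last a L (Row a a L g) x (ℕ.<⇒≤ a+L<N) ε |ε|)
          (RowsFrom-local 0 a L (Row-∣last a a L g x a+L<N) ε |ε|)

  -- C b c ε = (-q)^(number of pairs + before - in ε) if ε has b pluses and c minuses, else 0.
  signs : Seq → ℕ → ℕ → ℚ
  signs []          zero    zero    = 1ℚ
  signs (true ∷ ε)  (suc b) c       = (- q) ^ c * signs ε b c
  signs (false ∷ ε) b       (suc c) = signs ε b c
  signs _           _       _       = 0ℚ

  C : ℕ → ℕ → Coeffs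
  C b c ε = signs ε b c

  C-≢length : ∀ b c ε → length ε ≢ b ℕ.+ c → C b c ε ≡ 0ℚ
  C-≢length zero    zero    []          ε≢ = ⊥-elim (ε≢ refl)
  C-≢length zero    (suc c) []          ε≢ = refl
  C-≢length (suc b) c       []          ε≢ = refl
  C-≢length zero    c       (true ∷ ε)  ε≢ = refl
  C-≢length (suc b) c       (true ∷ ε)  ε≢ =
    trans (cong ((- q) ^ c *_) (C-≢length b c ε (ε≢ ∘ cong suc))) (ℚ.*-zeroʳ ((- q) ^ c))
  C-≢length b       zero    (false ∷ ε) ε≢ = refl
  C-≢length b       (suc c) (false ∷ ε) ε≢ = C-≢length b c ε (λ eq → ε≢ (trans (cong suc eq) (sym (ℕ.+-suc b c))))

  C-∣last-0⁺ : ∀ c ε → (C 0 c ∣last true) ε ≡ 0ℚ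
  C-∣last-0⁺ zero    []          = refl
  C-∣last-0⁺ (suc c) []          = refl
  C-∣last-0⁺ c       (true ∷ ε)  = refl
  C-∣last-0⁺ zero    (false ∷ ε) = refl
  C-∣last-0⁺ (suc c) (false ∷ ε) = C-∣last-0⁺ c ε

  C-∣last-⁺ : ∀ b c ε → (C (suc b) c ∣last true) ε ≡ C b c ε
  C-∣last-⁺ zero    zero    []          = refl
  C-∣last-⁺ zero    (suc c) []          = ℚ.*-zeroʳ ((- q) ^ suc c)
  C-∣last-⁺ (suc b) c       []          = ℚ.*-zeroʳ ((- q) ^ c)
  C-∣last-⁺ zero    c       (true ∷ ε)  = trans (cong ((- q) ^ c *_) (C-∣last-0⁺ c ε)) (ℚ.*-zeroʳ ((- q) ^ c))
  C-∣last-⁺ (suc b) c       (true ∷ ε)  = cong ((- q) ^ c *_) (C-∣last-⁺ b c ε)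
  C-∣last-⁺ b       zero    (false ∷ ε) = refl
  C-∣last-⁺ b       (suc c) (false ∷ ε) = C-∣last-⁺ b c ε

  C-∣last-0⁻ : ∀ b ε → (C b 0 ∣last false) ε ≡ 0ℚ
  C-∣last-0⁻ zero    []          = refl
  C-∣last-0⁻ (suc b) []          = refl
  C-∣last-0⁻ zero    (true ∷ ε)  = refl
  C-∣last-0⁻ (suc b) (true ∷ ε)  = trans (ℚ.*-identityˡ ((C b 0 ∣last false) ε)) (C-∣last-0⁻ b ε)
  C-∣last-0⁻ b       (false ∷ ε) = refl

  C-∣last-⁻ : ∀ b c ε → (C b (suc c) ∣last false) ε ≡ (- q) ^ b * C b c ε
  C-∣last-⁻ zero    zero    []          = refl
  C-∣last-⁻ zero    (suc c) []          = refl
  C-∣last-⁻ (suc b) c       []          = sym (ℚ.*-zeroʳ ((- q) ^ suc b))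
  C-∣last-⁻ zero    c       (true ∷ ε)  = refl
  C-∣last-⁻ (suc b) c       (true ∷ ε)  = begin
    (- q) ^ suc c * (C b (suc c) ∣last false) ε   ≡⟨ cong ((- q) ^ suc c *_) (C-∣last-⁻ b c ε) ⟩
    (- q) ^ suc c * ((- q) ^ b * C b c ε)         ≡⟨ ring (- q) ((- q) ^ c) ((- q) ^ b) (C b c ε) ⟩
    (- q) ^ suc b * ((- q) ^ c * C b c ε)         ∎
    where
    ring : ∀ m u w x → (m * u) * (w * x) ≡ (m * w) * (u * x)
    ring = solve-∀ ℚ-ring
  C-∣last-⁻ b       zero    (false ∷ ε) = trans (C-∣last-0⁻ b ε) (sym (ℚ.*-zeroʳ ((- q) ^ b)))
  C-∣last-⁻ b       (suc c) (false ∷ ε) = C-∣last-⁻ b c ε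

  -- One row of X_λ applied to + ⊗ C b c

  A B : ℕ → ℕ → ℕ → ℚ
  A K b c = (- 1ℚ) ^ b * q ^ c * E′ (q * q ^ K * q ^ b)
  B K b c = - (q * q ^ K * q ^ K * q ^ b * q ^ c) * E′ (q * q ^ b)

  -- E (K+1) times the coefficients of the words δ u under one row with shifts K+1, …
  rowOut : ℕ → ℕ → ℕ → Bool → Coeffs
  rowOut K b c       true  ε = A K b c * C b c ε
  rowOut K b zero    false ε = 0ℚ
  rowOut K b (suc c) false ε = B K b (suc c) * C (suc b) c ε

  -- E (K+2) times the coefficients of the words ε u w under one row with shifts K+2, …,
  -- by rowOut for the row one shorter.
  lastTwo : ℕ → Bool → Bool → ℕ → ℕ → Coeffs
  lastTwo K u true  zero    c       ε = 0ℚ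
  lastTwo K u true  (suc b) c       ε = rowOut (suc K) b c u ε
  lastTwo K u false b       zero    ε = 0ℚ
  lastTwo K u false b       (suc c) ε = (- q) ^ b * rowOut (suc K) b c u ε

  qp≡1 : q * p ≡ 1ℚ
  qp≡1 = *-invʳ q≢0

  p≢0 : p ≢ 0ℚ
  p≢0 p≡0 = ℚ.1≢0 (trans (sym qp≡1) (trans (cong (q *_) p≡0) (ℚ.*-zeroʳ q)))

  pairTq : Bool → Bool → ℚ → ℚ → ℚ
  pairTq true  false s o = q * s
  pairTq false true  s o = q * s + (q * q - 1ℚ) * o
  pairTq true  true  s o = - o
  pairTq false false s o = - o

  q*-p*o≡-o : ∀ o → q * (- p * o) ≡ - o
  q*-p*o≡-o o = trans (ring q p o) (trans (cong (λ x → - (x * o)) qp≡1) (cong -_ (ℚ.*-identityˡ o)))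
    where
    ring : ∀ q p o → q * (- p * o) ≡ - ((q * p) * o)
    ring = solve-∀ ℚ-ring

  q*pairT : ∀ y x s o → q * pairT y x s o ≡ pairTq y x s o
  q*pairT true  false s o = refl
  q*pairT false true  s o = trans (ring q p s o) (cong (λ x → q * s + (q * q - x) * o) qp≡1)
    where
    ring : ∀ q p s o → q * (s + (q - p) * o) ≡ q * s + (q * q - q * p) * o
    ring = solve-∀ ℚ-ring
  q*pairT true  true  s o = q*-p*o≡-o o
  q*pairT false false s o = q*-p*o≡-o o

  sign-cancel : ∀ b → (- 1ℚ) ^ b * (- q) ^ b ≡ q ^ b
  sign-cancel zero    = refl
  sign-cancel (suc b) = trans (ring q ((- 1ℚ) ^ b) ((- q) ^ b)) (cong (q *_) (sign-cancel b))
    where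
    ring : ∀ q m u → (- 1ℚ * m) * (- q * u) ≡ q * (m * u)
    ring = solve-∀ ℚ-ring

  A-signed : ∀ K b c X → (- q) ^ b * (A K b c * X) ≡ q ^ b * q ^ c * E′ (q * q ^ K * q ^ b) * X
  A-signed K b c X = begin
    (- q) ^ b * ((- 1ℚ) ^ b * q ^ c * e * X)   ≡⟨ ring ((- q) ^ b) ((- 1ℚ) ^ b) (q ^ c) e X ⟩
    ((- 1ℚ) ^ b * (- q) ^ b) * q ^ c * e * X   ≡⟨ cong (λ x → x * q ^ c * e * X) (sign-cancel b) ⟩
    q ^ b * q ^ c * e * X                      ∎
    where
    e = E′ (q * q ^ K * q ^ b)
    ring : ∀ s m y e X → s * (m * y * e * X) ≡ (m * s) * y * e * X
    ring = solve-∀ ℚ-ring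

  A-shift : ∀ K b c → A K (suc b) c ≡ - A (suc K) b c
  A-shift K b c = ring q (q ^ K) (q ^ b) (q ^ c) ((- 1ℚ) ^ b)
    where
    ring : ∀ q k β γ σ → (- 1ℚ * σ) * γ * ((q * k * (q * β)) * (q * k * (q * β)) - 1ℚ) ≡ - (σ * γ * ((q * (q * k) * β) * (q * (q * k) * β) - 1ℚ))
    ring = solve-∀ ℚ-ring

  B-shift : ∀ K b c → B (suc K) b c ≡ q * B K b (suc c)
  B-shift K b c = ring q (q ^ K) (q ^ b) (q ^ c)
    where
    ring : ∀ q k β γ → - (q * (q * k) * (q * k) * β * γ) * ((q * β) * (q * β) - 1ℚ) ≡ q * (- (q * k * k * β * (q * γ)) * ((q * β) * (q * β) - 1ℚ))
    ring = solve-∀ ℚ-ring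

  same-letters : ∀ K a → E (suc K) * (- a) - N (suc K) * a ≡ E (suc (suc K)) * (- a)
  same-letters K a = begin
    E (suc K) * (- a) - N (suc K) * a     ≡⟨ ring (E (suc K)) (N (suc K)) a ⟩
    (E (suc K) + N (suc K)) * (- a)       ≡⟨ cong (_* (- a)) (E+N≡E (suc K)) ⟩
    E (suc (suc K)) * (- a)               ∎
    where
    ring : ∀ e n a → e * (- a) - n * a ≡ (e + n) * (- a)
    ring = solve-∀ ℚ-ring

  module Abbreviations (K : ℕ) where
    E₁ E₂ N₁ : ℚ
    E₁ = E (suc K)
    E₂ = E (suc (suc K))
    N₁ = N (suc K)

  -- The statement of the one-row lemma's inductive step, on the last two letters y w.
  RowStep : ℕ → Bool → Bool → ℕ → ℕ → Seq → Set
  RowStep K y w b c ε =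
    E (suc K) * pairTq y w (lastTwo K w y b c ε) (lastTwo K y w b c ε) - N (suc K) * lastTwo K y w b c ε
      ≡ E (suc (suc K)) * rowOut K b c w (ε ++ y ∷ [])

  rowStep-⁺⁺ : ∀ K b c ε → b ℕ.+ c ≡ suc (length ε) → RowStep K true true b c ε
  rowStep-⁺⁺ K zero    c ε _ =
    trans (e*-0-n*0≡0 E₁ N₁) (sym (trans (cong (λ x → E₂ * (A K 0 c * x)) (C-∣last-0⁺ c ε)) (e*[a*0]≡0 E₂ (A K 0 c))))
    where open Abbreviations K
  rowStep-⁺⁺ K (suc b) c ε _ = begin
    E₁ * (- a) - N₁ * a                       ≡⟨ same-letters K a ⟩
    E₂ * (- a)                                ≡⟨ cong (E₂ *_) (ℚ.neg-distribˡ-* (A (suc K) b c) (C b c ε)) ⟩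
    E₂ * (- A (suc K) b c * C b c ε)          ≡⟨ cong₂ (λ u x → E₂ * (u * x)) (sym (A-shift K b c)) (sym (C-∣last-⁺ b c ε)) ⟩
    E₂ * (A K (suc b) c * C (suc b) c (ε ++ true ∷ [])) ∎
    where
    open Abbreviations K
    a = A (suc K) b c * C b c ε

  rowStep-⁻⁻ : ∀ K b c ε → b ℕ.+ c ≡ suc (length ε) → RowStep K false false b c ε
  rowStep-⁻⁻ K b zero          ε _ = trans (e*-0-n*0≡0 E₁ N₁) (sym (ℚ.*-zeroʳ E₂))
    where open Abbreviations K
  rowStep-⁻⁻ K b (suc zero)    ε _ =
    trans (e*-[s*0]-n*[s*0]≡0 E₁ N₁ ((- q) ^ b))
          (sym (trans (cong (λ x → E₂ * (B K b 1 * x)) (C-∣last-0⁻ (suc b) ε)) (e*[a*0]≡0 E₂ (B K b 1))))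
    where open Abbreviations K
  rowStep-⁻⁻ K b (suc (suc c)) ε _ = begin
    E₁ * (- a) - N₁ * a                       ≡⟨ same-letters K a ⟩
    E₂ * (- a)                                ≡⟨ cong (λ x → E₂ * (- ((- q) ^ b * (x * C (suc b) c ε)))) (B-shift K b (suc c)) ⟩
    E₂ * (- ((- q) ^ b * (q * B K b (suc (suc c)) * C (suc b) c ε)))
                                              ≡⟨ cong (E₂ *_) (ring ((- q) ^ b) q (B K b (suc (suc c))) (C (suc b) c ε)) ⟩
    E₂ * (B K b (suc (suc c)) * ((- q) ^ suc b * C (suc b) c ε))
                                              ≡⟨ cong (λ x → E₂ * (B K b (suc (suc c)) * x)) (C-∣last-⁻ (suc b) c ε) ⟨
    E₂ * (B K b (suc (suc c)) * C (suc b) (suc c) (ε ++ false ∷ [])) ∎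
    where
    open Abbreviations K
    a = (- q) ^ b * (B (suc K) b (suc c) * C (suc b) c ε)
    ring : ∀ s q B Cε → - (s * (q * B * Cε)) ≡ B * ((- q * s) * Cε)
    ring = solve-∀ ℚ-ring

  rowStep-⁺⁻ : ∀ K b c ε → b ℕ.+ c ≡ suc (length ε) → RowStep K true false b c ε
  rowStep-⁺⁻ K zero    zero    ε ()
  rowStep-⁺⁻ K (suc b) zero    ε _ = trans (e*[q*0]-n*0≡0 E₁ N₁ q) (sym (ℚ.*-zeroʳ E₂))
    where open Abbreviations K
  rowStep-⁺⁻ K zero    (suc c) ε _ = begin
    E₁ * (q * 0ℚ) - N₁ * (1ℚ * (A (suc K) 0 c * Cε))  ≡⟨ ring q (q ^ K) (q ^ c) Cε ⟩
    E₂ * (B K 0 (suc c) * Cε)                         ≡⟨ cong (λ x → E₂ * (B K 0 (suc c) * x)) (C-∣last-⁺ 0 c ε) ⟨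
    E₂ * (B K 0 (suc c) * C 1 c (ε ++ true ∷ []))    ∎
    where
    open Abbreviations K
    Cε = C 0 c ε
    ring : ∀ q k γ Cε →
      ((q * k) * (q * k) - 1ℚ) * (q * 0ℚ) - (q * k) * (q * k) * (q * q - 1ℚ) * (1ℚ * (1ℚ * γ * ((q * (q * k) * 1ℚ) * (q * (q * k) * 1ℚ) - 1ℚ) * Cε))
        ≡ ((q * (q * k)) * (q * (q * k)) - 1ℚ) * (- (q * k * k * 1ℚ * (q * γ)) * ((q * 1ℚ) * (q * 1ℚ) - 1ℚ) * Cε)
    ring = solve-∀ ℚ-ring
  rowStep-⁺⁻ K (suc b) (suc c) ε _ = begin
    E₁ * (q * (B (suc K) b (suc c) * Cε)) - N₁ * ((- q) ^ suc b * (A (suc K) (suc b) c * Cε))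
      ≡⟨ cong (λ x → E₁ * (q * (B (suc K) b (suc c) * Cε)) - N₁ * x) (A-signed (suc K) (suc b) c Cε) ⟩
    E₁ * (q * (B (suc K) b (suc c) * Cε)) - N₁ * (q ^ suc b * q ^ c * E′ (q * q ^ suc K * q ^ suc b) * Cε)
      ≡⟨ ring q (q ^ K) (q ^ b) (q ^ c) Cε ⟩
    E₂ * (B K (suc b) (suc c) * Cε)
      ≡⟨ cong (λ x → E₂ * (B K (suc b) (suc c) * x)) (C-∣last-⁺ (suc b) c ε) ⟨
    E₂ * (B K (suc b) (suc c) * C (suc (suc b)) c (ε ++ true ∷ [])) ∎
    where
    open Abbreviations K
    Cε = C (suc b) c ε
    ring : ∀ q k β γ Cε →
      ((q * k) * (q * k) - 1ℚ) * (q * (- (q * (q * k) * (q * k) * β * (q * γ)) * ((q * β) * (q * β) - 1ℚ) * Cε))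
        - (q * k) * (q * k) * (q * q - 1ℚ) * (q * β * γ * ((q * (q * k) * (q * β)) * (q * (q * k) * (q * β)) - 1ℚ) * Cε)
        ≡ ((q * (q * k)) * (q * (q * k)) - 1ℚ) * (- (q * k * k * (q * β) * (q * γ)) * ((q * (q * β)) * (q * (q * β)) - 1ℚ) * Cε)
    ring = solve-∀ ℚ-ring

  rowStep-⁻⁺ : ∀ K b c ε → b ℕ.+ c ≡ suc (length ε) → RowStep K false true b c ε
  rowStep-⁻⁺ K zero    zero    ε ()
  rowStep-⁻⁺ K (suc b) zero    ε _ =
    trans (e*[q*0+d*0]-n*0≡0 E₁ N₁ q (q * q - 1ℚ))
          (sym (trans (cong (λ x → E₂ * (A K (suc b) 0 * x)) (C-∣last-0⁻ (suc b) ε)) (e*[a*0]≡0 E₂ (A K (suc b) 0))))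
    where open Abbreviations K
  rowStep-⁻⁺ K zero    (suc c) ε _ = begin
    E₁ * (q * (1ℚ * (A (suc K) 0 c * Cε)) + (q * q - 1ℚ) * 0ℚ) - N₁ * 0ℚ ≡⟨ ring q (q ^ K) (q ^ c) Cε ⟩
    E₂ * (A K 0 (suc c) * (1ℚ * Cε))                                    ≡⟨ cong (λ x → E₂ * (A K 0 (suc c) * x)) (C-∣last-⁻ 0 c ε) ⟨
    E₂ * (A K 0 (suc c) * C 0 (suc c) (ε ++ false ∷ []))               ∎
    where
    open Abbreviations K
    Cε = C 0 c ε
    ring : ∀ q k γ Cε →
      ((q * k) * (q * k) - 1ℚ) * (q * (1ℚ * (1ℚ * γ * ((q * (q * k) * 1ℚ) * (q * (q * k) * 1ℚ) - 1ℚ) * Cε)) + (q * q - 1ℚ) * 0ℚ)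
        - (q * k) * (q * k) * (q * q - 1ℚ) * 0ℚ
        ≡ ((q * (q * k)) * (q * (q * k)) - 1ℚ) * (1ℚ * (q * γ) * ((q * k * 1ℚ) * (q * k * 1ℚ) - 1ℚ) * (1ℚ * Cε))
    ring = solve-∀ ℚ-ring
  rowStep-⁻⁺ K (suc b) (suc c) ε _ = begin
    E₁ * (q * s₁ + (q * q - 1ℚ) * o) - N₁ * o
      ≡⟨ cong (λ x → E₁ * (q * x + (q * q - 1ℚ) * o) - N₁ * o) (A-signed (suc K) (suc b) c Cε) ⟩
    E₁ * (q * (q ^ suc b * q ^ c * E′ (q * q ^ suc K * q ^ suc b) * Cε) + (q * q - 1ℚ) * o) - N₁ * o
      ≡⟨ ring q (q ^ K) (q ^ b) (q ^ c) Cε ⟩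
    E₂ * (q ^ suc b * q ^ suc c * E′ (q * q ^ K * q ^ suc b) * Cε)
      ≡⟨ cong (E₂ *_) (trans (x∙yz≡y∙xz (A K (suc b) (suc c)) ((- q) ^ suc b) Cε) (A-signed K (suc b) (suc c) Cε)) ⟨
    E₂ * (A K (suc b) (suc c) * ((- q) ^ suc b * Cε))
      ≡⟨ cong (λ x → E₂ * (A K (suc b) (suc c) * x)) (C-∣last-⁻ (suc b) c ε) ⟨
    E₂ * (A K (suc b) (suc c) * C (suc b) (suc c) (ε ++ false ∷ [])) ∎
    where
    open Abbreviations K
    Cε = C (suc b) c ε
    s₁ = (- q) ^ suc b * (A (suc K) (suc b) c * Cε)
    o = B (suc K) b (suc c) * Cε
    ring : ∀ q k β γ Cε →
      ((q * k) * (q * k) - 1ℚ) * (q * (q * β * γ * ((q * (q * k) * (q * β)) * (q * (q * k) * (q * β)) - 1ℚ) * Cε)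
                                  + (q * q - 1ℚ) * (- (q * (q * k) * (q * k) * β * (q * γ)) * ((q * β) * (q * β) - 1ℚ) * Cε))
        - (q * k) * (q * k) * (q * q - 1ℚ) * (- (q * (q * k) * (q * k) * β * (q * γ)) * ((q * β) * (q * β) - 1ℚ) * Cε)
        ≡ ((q * (q * k)) * (q * (q * k)) - 1ℚ) * (q * β * (q * γ) * ((q * k * (q * β)) * (q * k * (q * β)) - 1ℚ) * Cε)
    ring = solve-∀ ℚ-ring

  single-minuses : ∀ m ε → single (replicate m false) 1ℚ ε ≡ C 0 m ε
  single-minuses zero    []          = refl
  single-minuses zero    (true ∷ ε)  = refl
  single-minuses zero    (false ∷ ε) = refl
  single-minuses (suc m) []          = refl
  single-minuses (suc m) (true ∷ ε)  = refl
  single-minuses (suc m) (false ∷ ε) = single-minuses m ε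

  C-coinv : ∀ ε → C (countPlus ε) (countMinus ε) ε ≡ (- q) ^ coinv ε
  C-coinv []          = refl
  C-coinv (true ∷ ε)  = trans (cong ((- q) ^ countMinus ε *_) (C-coinv ε)) (sym (^-homo-* (- q) (countMinus ε) (coinv ε)))
  C-coinv (false ∷ ε) = C-coinv ε

  rowStep : ∀ K y w b c ε → b ℕ.+ c ≡ suc (length ε) → RowStep K y w b c ε
  rowStep K true  true  = rowStep-⁺⁺ K
  rowStep K false false = rowStep-⁻⁻ K
  rowStep K true  false = rowStep-⁺⁻ K
  rowStep K false true  = rowStep-⁻⁺ K

  Row-scaled : ∀ K L s g h → (∀ δ → g δ ≡ s * h δ) → ∀ x → length x ≡ suc L →
               Row 0 K L (prefixPlus 1 g) x ≡ s * Row 0 K L (prefixPlus 1 h) x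
  Row-scaled K L s g h g≡ x |x| = begin
    Row 0 K L (prefixPlus 1 g) x                       ≡⟨ Row-local 0 K L (prefixPlus-cong 1 (λ δ _ → g≡ δ)) x |x| ⟩
    Row 0 K L (prefixPlus 1 (λ δ → s * h δ)) x         ≡⟨ Row-local 0 K L {suc L} (λ δ _ → prefixPlus-homogeneous 1 s h δ) x |x| ⟩
    Row 0 K L (λ δ → s * prefixPlus 1 h δ) x           ≡⟨ Row-homogeneous 0 K L s (prefixPlus 1 h) x ⟩
    s * Row 0 K L (prefixPlus 1 h) x                   ∎

  reducedPower : ℕ → ℚ
  reducedPower zero    = 0ℚ
  reducedPower (suc c) = (- q) ^ suc c

  shiftedPower↦ : ∀ c → ((0ℚ ∷ map (λ z → z ℚ./ 1) (shiftedPower c)) // (1ℚ ∷ [])) ↦[ q ] reducedPower c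
  shiftedPower↦ c = defined (subst (_≢ 0ℚ) (sym (evalP-singleton 1ℚ q)) ℚ.1≢0) (num≡ c)
    where
    num≡ : ∀ c → 0ℚ + q * evalP (map (λ z → z ℚ./ 1) (shiftedPower c)) q ≡ reducedPower c * (1ℚ + q * 0ℚ)
    num≡ zero    = ring q
      where
      ring : ∀ q → 0ℚ + q * 0ℚ ≡ 0ℚ * (1ℚ + q * 0ℚ)
      ring = solve-∀ ℚ-ring
    num≡ (suc c) = begin
      0ℚ + q * evalP (map (λ z → z ℚ./ 1) (replicate c (ℤ.+ 0) ++ signℤ (suc c) ∷ [])) q
        ≡⟨ cong (λ l → 0ℚ + q * evalP l q) (trans (List.map-++ (λ z → z ℚ./ 1) (replicate c (ℤ.+ 0)) _)
                                                  (cong (_++ signℤ (suc c) ℚ./ 1 ∷ []) (List.map-replicate (λ z → z ℚ./ 1) c (ℤ.+ 0)))) ⟩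
      0ℚ + q * evalP (replicate c 0ℚ ++ signℤ (suc c) ℚ./ 1 ∷ []) q
        ≡⟨ cong (λ x → 0ℚ + q * x) (evalP-++ (replicate c 0ℚ) _ q) ⟩
      0ℚ + q * (evalP (replicate c 0ℚ) q + q ^ length (replicate c 0ℚ) * evalP (signℤ (suc c) ℚ./ 1 ∷ []) q)
        ≡⟨ cong₂ (λ x y → 0ℚ + q * (x + q ^ y * evalP (signℤ (suc c) ℚ./ 1 ∷ []) q)) (evalP-zeros c q) (List.length-replicate c) ⟩
      0ℚ + q * (0ℚ + q ^ c * evalP (signℤ (suc c) ℚ./ 1 ∷ []) q)
        ≡⟨ cong (λ x → 0ℚ + q * (0ℚ + q ^ c * x)) (trans (evalP-singleton _ q) (signℤ-value (suc c))) ⟩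
      0ℚ + q * (0ℚ + q ^ c * (- 1ℚ * (- 1ℚ) ^ c))
        ≡⟨ ring q (q ^ c) ((- 1ℚ) ^ c) ⟩
      (- q) * ((- 1ℚ) ^ c * q ^ c) * (1ℚ + q * 0ℚ)
        ≡⟨ cong (λ x → (- q) * x * (1ℚ + q * 0ℚ)) (trans (cong (_^ c) (neg-as-product q)) (^-distrib-* (- 1ℚ) q c)) ⟨
      (- q) ^ suc c * (1ℚ + q * 0ℚ) ∎
      where
      neg-as-product : ∀ q → - q ≡ - 1ℚ * q
      neg-as-product = solve-∀ ℚ-ring
      ring : ∀ q y s → 0ℚ + q * (0ℚ + y * (- 1ℚ * s)) ≡ (- q) * (s * y) * (1ℚ + q * 0ℚ)
      ring = solve-∀ ℚ-ring

  module Nondegenerate (E≢0 : ∀ r → E (suc r) ≢ 0ℚ) where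

    ratio-den≢0 : ∀ r → denAt (ratio (suc r)) q ≢ 0ℚ
    ratio-den≢0 r = subst (_≢ 0ℚ) (sym (denAt-ratio (suc r) q)) (*-≢0 (E≢0 r) q≢0)

    E*κ≡N : ∀ r → E (suc r) * κ (suc r) ≡ N (suc r)
    E*κ≡N r = begin
      E r′ * (q * s)                          ≡⟨ ring (q ^ r′) q s ⟩
      s * ((q ^ r′ * q ^ r′ - 1ℚ) * q)        ≡⟨ ratio-value r′ (ratio-den≢0 r) ⟩
      q ^ r′ * (q ^ r′ * (q * q - 1ℚ))        ≡⟨ ℚ.*-assoc (q ^ r′) (q ^ r′) _ ⟨
      N r′                                    ∎
      where
      r′ = suc r
      s = evalF q (ratio r′)
      ring : ∀ x q s → (x * x - 1ℚ) * (q * s) ≡ s * ((x * x - 1ℚ) * q)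
      ring = solve-∀ ℚ-ring

    OneRow : ℕ → ℕ → Set
    OneRow L K = ∀ b c u → b ℕ.+ c ≡ L → ∀ ε → length ε ≡ L →
                 E (suc K) * Row 0 K L (prefixPlus 1 (C b c)) (ε ++ u ∷ []) ≡ rowOut K b c u ε

    lastTwo-correct : ∀ K L b c → b ℕ.+ c ≡ suc L → OneRow L (suc K) → ∀ ε → length ε ≡ L → ∀ u v →
      E (suc (suc K)) * Row 0 (suc K) L (prefixPlus 1 (C b c)) (ε ++ u ∷ v ∷ []) ≡ lastTwo K u v b c ε
    lastTwo-correct K L b c b+c≡ oneRow ε |ε| u v = trans (cong (E₂ *_) (trans restrict-v (prefix-∣last v))) (finish v b c b+c≡)
      where
      open Abbreviations K
      R = Row 0 (suc K) L
      εu = ε ++ u ∷ []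
      |εu| : length εu ≡ suc L
      |εu| = trans (List.length-++ ε) (trans (ℕ.+-comm (length ε) 1) (cong suc |ε|))
      restrict-v : R (prefixPlus 1 (C b c)) (ε ++ u ∷ v ∷ []) ≡ R (prefixPlus 1 (C b c) ∣last v) εu
      restrict-v = trans (cong (R (prefixPlus 1 (C b c))) (sym (List.++-assoc ε (u ∷ []) (v ∷ []))))
                         (Row-∣last 0 (suc K) L (prefixPlus 1 (C b c)) v ℕ.≤-refl εu |εu|)
      prefix-∣last : ∀ v → R (prefixPlus 1 (C b c) ∣last v) εu ≡ R (prefixPlus 1 (C b c ∣last v)) εu
      prefix-∣last v = Row-local 0 (suc K) L
        (λ δ |δ| → prefixPlus-∣last 1 (C b c) v δ (subst (1 ≤_) (sym |δ|) (s≤s z≤n))) εu |εu|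
      vanishing : ∀ g → (∀ δ → g δ ≡ 0ℚ) → E₂ * R (prefixPlus 1 g) εu ≡ 0ℚ
      vanishing g g≡0 = begin
        E₂ * R (prefixPlus 1 g) εu
          ≡⟨ cong (E₂ *_) (Row-scaled (suc K) L 0ℚ g g (λ δ → trans (g≡0 δ) (sym (ℚ.*-zeroˡ (g δ)))) εu |εu|) ⟩
        E₂ * (0ℚ * R (prefixPlus 1 g) εu)            ≡⟨ e*[0*a]≡0 E₂ (R (prefixPlus 1 g) εu) ⟩
        0ℚ                                           ∎
      finish : ∀ v b c → b ℕ.+ c ≡ suc L → E₂ * R (prefixPlus 1 (C b c ∣last v)) εu ≡ lastTwo K u v b c ε
      finish true  zero    c _    = vanishing (C 0 c ∣last true) (C-∣last-0⁺ c)
      finish true  (suc b) c b+c≡ = trans (cong (E₂ *_) (Row-scaled (suc K) L 1ℚ _ (C b c) (λ δ → trans (C-∣last-⁺ b c δ) (sym (ℚ.*-identityˡ _))) εu |εu|))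
                                           (trans (cong (E₂ *_) (ℚ.*-identityˡ _)) (oneRow b c u (ℕ.suc-injective b+c≡) ε |ε|))
      finish false b       zero    _    = vanishing (C b 0 ∣last false) (C-∣last-0⁻ b)
      finish false b       (suc c) b+c≡ = begin
        E₂ * R (prefixPlus 1 (C b (suc c) ∣last false)) εu   ≡⟨ cong (E₂ *_) (Row-scaled (suc K) L ((- q) ^ b) _ (C b c) (C-∣last-⁻ b c) εu |εu|) ⟩
        E₂ * ((- q) ^ b * R (prefixPlus 1 (C b c)) εu)        ≡⟨ x∙yz≡y∙xz E₂ ((- q) ^ b) _ ⟩
        (- q) ^ b * (E₂ * R (prefixPlus 1 (C b c)) εu)        ≡⟨ cong ((- q) ^ b *_) (oneRow b c u (ℕ.suc-injective (trans (sym (ℕ.+-suc b c)) b+c≡)) ε |ε|) ⟩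
        (- q) ^ b * rowOut (suc K) b c u ε                    ∎

    oneRow : ∀ L K → OneRow L K
    oneRow zero    K zero zero true  refl [] refl = ring q (q ^ K)
      where
      ring : ∀ q k → ((q * k) * (q * k) - 1ℚ) * 1ℚ ≡ (1ℚ * 1ℚ * ((q * k * 1ℚ) * (q * k * 1ℚ) - 1ℚ)) * 1ℚ
      ring = solve-∀ ℚ-ring
    oneRow zero    K zero zero false refl [] refl = ℚ.*-zeroʳ (E (suc K))
    oneRow (suc L) K b    c    w    b+c≡ ε |ε| with snoc-view ε L |ε|
    ... | ε′ , y , refl , |ε′| = *-cancelˡ (E≢0 (suc K)) (begin
      E₂ * (E₁ * Row 0 K (suc L) G ((ε′ ++ y ∷ []) ++ w ∷ []))
        ≡⟨ cong (λ x → E₂ * (E₁ * Row 0 K (suc L) G x)) (List.++-assoc ε′ (y ∷ []) (w ∷ [])) ⟩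
      E₂ * (E₁ * (q * coeffT (suc L) Z (ε′ ++ y ∷ w ∷ []) - κ (suc K) * Z₀))
        ≡⟨ cong (λ x → E₂ * (E₁ * (q * x - κ (suc K) * Z₀))) at-y-w ⟩
      E₂ * (E₁ * (q * pairT y w Z₁ Z₀ - κ (suc K) * Z₀))
        ≡⟨ ring E₂ E₁ q (pairT y w Z₁ Z₀) (κ (suc K)) Z₀ ⟩
      E₁ * (q * (E₂ * pairT y w Z₁ Z₀)) - (E₁ * κ (suc K)) * (E₂ * Z₀)
        ≡⟨ cong₂ (λ u v → E₁ * (q * u) - v * (E₂ * Z₀)) (sym (pairT-scale y w E₂ Z₁ Z₀)) (E*κ≡N K) ⟩
      E₁ * (q * pairT y w (E₂ * Z₁) (E₂ * Z₀)) - N₁ * (E₂ * Z₀)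
        ≡⟨ cong (λ u → E₁ * u - N₁ * (E₂ * Z₀)) (q*pairT y w (E₂ * Z₁) (E₂ * Z₀)) ⟩
      E₁ * pairTq y w (E₂ * Z₁) (E₂ * Z₀) - N₁ * (E₂ * Z₀)
        ≡⟨ cong₂ (λ u v → E₁ * pairTq y w u v - N₁ * v) (last-two w y) (last-two y w) ⟩
      E₁ * pairTq y w (lastTwo K w y b c ε′) (lastTwo K y w b c ε′) - N₁ * lastTwo K y w b c ε′
        ≡⟨ rowStep K y w b c ε′ (trans b+c≡ (cong suc (sym |ε′|))) ⟩
      E₂ * rowOut K b c w (ε′ ++ y ∷ []) ∎)
      where
      open Abbreviations K
      G = prefixPlus 1 (C b c)
      Z = Row 0 (suc K) L G
      Z₁ = Z (ε′ ++ w ∷ y ∷ [])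
      Z₀ = Z (ε′ ++ y ∷ w ∷ [])
      at-y-w : coeffT (suc L) Z (ε′ ++ y ∷ w ∷ []) ≡ pairT y w Z₁ Z₀
      at-y-w = subst (λ n → coeffT (suc n) Z (ε′ ++ y ∷ w ∷ []) ≡ pairT y w Z₁ Z₀) |ε′| (coeffT-at Z ε′ y w [])
      last-two : ∀ u v → E₂ * Z (ε′ ++ u ∷ v ∷ []) ≡ lastTwo K u v b c ε′
      last-two = lastTwo-correct K L b c b+c≡ (oneRow L (suc K)) ε′ |ε′|
      ring : ∀ e₂ e₁ q t k z → e₂ * (e₁ * (q * t - k * z)) ≡ e₁ * (q * (e₂ * t)) - (e₁ * k) * (e₂ * z)
      ring = solve-∀ ℚ-ring

    -- All rows of X_λ applied to +ᵃ ⊗ C b c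

    Eprod : ℕ → ℚ
    Eprod zero    = 1ℚ
    Eprod (suc a) = E (suc a) * Eprod a

    Eprod-≢0 : ∀ a → Eprod a ≢ 0ℚ
    Eprod-≢0 zero    = ℚ.1≢0
    Eprod-≢0 (suc a) = *-≢0 (E≢0 a) (Eprod-≢0 a)

    rowsCoeff : ℕ → ℕ → ℕ → ℚ
    rowsCoeff zero    b c = 1ℚ
    rowsCoeff (suc a) b c = A a b c * rowsCoeff a b c

    B-≢0 : ∀ a b c → B a b c ≢ 0ℚ
    B-≢0 a b c = *-≢0 (neg-≢0 (*-≢0 (*-≢0 (*-≢0 (*-≢0 q≢0 (q^≢0 a)) (q^≢0 a)) (q^≢0 b)) (q^≢0 c))) (E≢0 b)
      where
      q^≢0 : ∀ n → q ^ n ≢ 0ℚ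
      q^≢0 n = ^-≢0 n q≢0

    rowsCoeff-step : ∀ a b c → B a b (suc c) * rowsCoeff a (suc b) c ≡ rowsCoeff (suc a) b (suc c) * (- q) ^ suc (a ℕ.+ b)
    rowsCoeff-step zero    b c = begin
      B 0 b (suc c) * 1ℚ
        ≡⟨ ring₁ q (q ^ b) (q ^ c) ⟩
      q ^ b * (- (q * q * q ^ c) * E′ (q * 1ℚ * q ^ b))
        ≡⟨ cong (_* (- (q * q * q ^ c) * E′ (q * 1ℚ * q ^ b))) (sign-cancel b) ⟨
      ((- 1ℚ) ^ b * (- q) ^ b) * (- (q * q * q ^ c) * E′ (q * 1ℚ * q ^ b))
        ≡⟨ ring₂ ((- 1ℚ) ^ b) ((- q) ^ b) q (q ^ c) (E′ (q * 1ℚ * q ^ b)) ⟩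
      ((- 1ℚ) ^ b * (q * q ^ c) * E′ (q * 1ℚ * q ^ b) * 1ℚ) * (- q * (- q) ^ b) ∎
      where
      ring₁ : ∀ q β γ → - (q * 1ℚ * 1ℚ * β * (q * γ)) * ((q * β) * (q * β) - 1ℚ) * 1ℚ
                           ≡ β * (- (q * q * γ) * ((q * 1ℚ * β) * (q * 1ℚ * β) - 1ℚ))
      ring₁ = solve-∀ ℚ-ring
      ring₂ : ∀ σ s q γ e → (σ * s) * (- (q * q * γ) * e) ≡ (σ * (q * γ) * e * 1ℚ) * (- q * s)
      ring₂ = solve-∀ ℚ-ring
    rowsCoeff-step (suc a) b c = *-cancelˡ (B-≢0 a b (suc c)) (begin
      B₀ * (B₁ * (A₀ * κ₀))      ≡⟨ ring₁ B₀ B₁ A₀ κ₀ ⟩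
      B₁ * A₀ * (B₀ * κ₀)        ≡⟨ cong (B₁ * A₀ *_) (rowsCoeff-step a b c) ⟩
      B₁ * A₀ * (κ₁ * s)         ≡⟨ ring₂ q (q ^ a) (q ^ b) (q ^ c) ((- 1ℚ) ^ b) κ₁ s ⟩
      B₀ * (A (suc a) b (suc c) * κ₁ * (- q * s)) ∎)
      where
      B₀ = B a b (suc c)
      B₁ = B (suc a) b (suc c)
      A₀ = A a (suc b) c
      κ₀ = rowsCoeff a (suc b) c
      κ₁ = rowsCoeff (suc a) b (suc c)
      s = (- q) ^ suc (a ℕ.+ b)
      ring₁ : ∀ x y z w → x * (y * (z * w)) ≡ y * z * (x * w)
      ring₁ = solve-∀ ℚ-ring
      ring₂ : ∀ q α β γ σ k s →
        - (q * (q * α) * (q * α) * β * (q * γ)) * ((q * β) * (q * β) - 1ℚ) * ((- 1ℚ * σ) * γ * ((q * α * (q * β)) * (q * α * (q * β)) - 1ℚ)) * (k * s)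
          ≡ - (q * α * α * β * (q * γ)) * ((q * β) * (q * β) - 1ℚ) * (σ * (q * γ) * ((q * (q * α) * β) * (q * (q * α) * β) - 1ℚ) * k * (- q * s))
      ring₂ = solve-∀ ℚ-ring

    rowsCoeff-0 : ∀ a m → rowsCoeff a 0 m ≡ (q ^ m) ^ a * Eprod a
    rowsCoeff-0 zero    m = refl
    rowsCoeff-0 (suc a) m = trans (cong (A a 0 m *_) (rowsCoeff-0 a m)) (ring q (q ^ a) (q ^ m) ((q ^ m) ^ a) (Eprod a))
      where
      ring : ∀ q α μ x d → (1ℚ * μ * ((q * α * 1ℚ) * (q * α * 1ℚ) - 1ℚ)) * (x * d) ≡ (μ * x) * (((q * α) * (q * α) - 1ℚ) * d)
      ring = solve-∀ ℚ-ring

    Rows-prefixPlus-scaled : ∀ a L s f g → f ≗[ L ] (λ δ → s * g δ) →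
      Rows a L (prefixPlus a f) ≗[ a ℕ.+ L ] (λ ε → s * Rows a L (prefixPlus a g) ε)
    Rows-prefixPlus-scaled a L s f g f≗ ε |ε| = begin
      Rows a L (prefixPlus a f) ε                      ≡⟨ RowsFrom-local 0 a L (prefixPlus-cong a f≗) ε |ε| ⟩
      Rows a L (prefixPlus a (λ δ → s * g δ)) ε        ≡⟨ RowsFrom-local 0 a L {a ℕ.+ L} (λ δ _ → prefixPlus-homogeneous a s g δ) ε |ε| ⟩
      Rows a L (λ δ → s * prefixPlus a g δ) ε          ≡⟨ Rows-homogeneous a L s (prefixPlus a g) ε ⟩
      s * Rows a L (prefixPlus a g) ε                  ∎

    RowsLemma : ℕ → Set
    RowsLemma a = ∀ L b c → b ℕ.+ c ≡ L → ∀ ε → length ε ≡ a ℕ.+ L →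
                  Eprod a * Rows a L (prefixPlus a (C b c)) ε ≡ rowsCoeff a b c * C (a ℕ.+ b) c ε

    -- The row applied first moves the last of the a + 1 pluses; the others never touch the last letter.
    rows-peel : ∀ a L b c w → b ℕ.+ c ≡ L → ∀ ε → length ε ≡ a ℕ.+ L →
      E (suc a) * Eprod a * Rows (suc a) L (prefixPlus (suc a) (C b c)) (ε ++ w ∷ [])
        ≡ Eprod a * Rows a L (prefixPlus a (rowOut a b c w)) ε
    rows-peel a L b c w b+c≡ ε′ |ε′| = begin
      E (suc a) * Eprod a * Rows a L (Row a a L (prefixPlus (suc a) (C b c))) (ε′ ++ w ∷ [])
        ≡⟨ cong (E (suc a) * Eprod a *_) (Rows-∣last a L _ w ℕ.≤-refl ε′ |ε′|) ⟩
      E (suc a) * Eprod a * Rows a L (Row a a L (prefixPlus (suc a) (C b c)) ∣last w) ε′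
        ≡⟨ cong (E (suc a) * Eprod a *_) (RowsFrom-local 0 a L first-row ε′ |ε′|) ⟩
      E (suc a) * Eprod a * Rows a L (prefixPlus a (h ∣last w)) ε′
        ≡⟨ ring (E (suc a)) (Eprod a) _ ⟩
      Eprod a * (E (suc a) * Rows a L (prefixPlus a (h ∣last w)) ε′)
        ≡⟨ cong (Eprod a *_) (Rows-prefixPlus-scaled a L (E (suc a)) _ _ (λ δ _ → refl) ε′ |ε′|) ⟨
      Eprod a * Rows a L (prefixPlus a (λ δ → E (suc a) * (h ∣last w) δ)) ε′
        ≡⟨ cong (Eprod a *_) (RowsFrom-local 0 a L (prefixPlus-cong a (oneRow L a b c w b+c≡)) ε′ |ε′|) ⟩
      Eprod a * Rows a L (prefixPlus a (rowOut a b c w)) ε′ ∎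
      where
      h = Row 0 a L (prefixPlus 1 (C b c))
      ring : ∀ e d r → e * d * r ≡ d * (e * r)
      ring = solve-∀ ℚ-ring
      first-row : (Row a a L (prefixPlus (suc a) (C b c)) ∣last w) ≗[ a ℕ.+ L ] prefixPlus a (h ∣last w)
      first-row δ |δ| = begin
        Row a a L (prefixPlus (suc a) (C b c)) (δ ++ w ∷ [])
          ≡⟨ Row-local a a L {suc (a ℕ.+ L)} (λ x _ → prefixPlus-suc a (C b c) x) (δ ++ w ∷ []) |δw| ⟩
        Row a a L (prefixPlus a (prefixPlus 1 (C b c))) (δ ++ w ∷ [])
          ≡⟨ Row-prefixPlus a a L (prefixPlus 1 (C b c)) (δ ++ w ∷ []) ⟩
        prefixPlus a h (δ ++ w ∷ [])
          ≡⟨ prefixPlus-∣last a h w δ (subst (a ≤_) (sym |δ|) (ℕ.m≤m+n a L)) ⟩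
        prefixPlus a (h ∣last w) δ ∎
        where
        |δw| : length (δ ++ w ∷ []) ≡ suc (a ℕ.+ L)
        |δw| = trans (List.length-++ δ) (trans (ℕ.+-comm (length δ) 1) (cong suc |δ|))

    rows-lastLetter : ∀ a → RowsLemma a → ∀ L b c w → b ℕ.+ c ≡ L → ∀ ε′ → length ε′ ≡ a ℕ.+ L →
      Eprod a * Rows a L (prefixPlus a (rowOut a b c w)) ε′ ≡ rowsCoeff (suc a) b c * C (suc a ℕ.+ b) c (ε′ ++ w ∷ [])
    rows-lastLetter a rows-a L b c true b+c≡ ε′ |ε′| = begin
      Eprod a * Rows a L (prefixPlus a (rowOut a b c true)) ε′
        ≡⟨ cong (Eprod a *_) (Rows-prefixPlus-scaled a L (A a b c) _ (C b c) (λ δ _ → refl) ε′ |ε′|) ⟩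
      Eprod a * (A a b c * Rows a L (prefixPlus a (C b c)) ε′)
        ≡⟨ x∙yz≡y∙xz (Eprod a) (A a b c) _ ⟩
      A a b c * (Eprod a * Rows a L (prefixPlus a (C b c)) ε′)
        ≡⟨ cong (A a b c *_) (rows-a L b c b+c≡ ε′ |ε′|) ⟩
      A a b c * (rowsCoeff a b c * C (a ℕ.+ b) c ε′)
        ≡⟨ ℚ.*-assoc (A a b c) (rowsCoeff a b c) _ ⟨
      rowsCoeff (suc a) b c * C (a ℕ.+ b) c ε′
        ≡⟨ cong (rowsCoeff (suc a) b c *_) (C-∣last-⁺ (a ℕ.+ b) c ε′) ⟨
      rowsCoeff (suc a) b c * C (suc a ℕ.+ b) c (ε′ ++ true ∷ []) ∎
    rows-lastLetter a rows-a L b zero false _ ε′ |ε′| = begin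
      Eprod a * Rows a L (prefixPlus a (rowOut a b 0 false)) ε′
        ≡⟨ cong (Eprod a *_) (Rows-prefixPlus-scaled a L 0ℚ _ (C b 0) (λ δ _ → sym (ℚ.*-zeroˡ (C b 0 δ))) ε′ |ε′|) ⟩
      Eprod a * (0ℚ * Rows a L (prefixPlus a (C b 0)) ε′)
        ≡⟨ e*[0*a]≡0 (Eprod a) (Rows a L (prefixPlus a (C b 0)) ε′) ⟩
      0ℚ
        ≡⟨ trans (cong (rowsCoeff (suc a) b 0 *_) (C-∣last-0⁻ (suc a ℕ.+ b) ε′)) (ℚ.*-zeroʳ (rowsCoeff (suc a) b 0)) ⟨
      rowsCoeff (suc a) b 0 * C (suc a ℕ.+ b) 0 (ε′ ++ false ∷ []) ∎
    rows-lastLetter a rows-a L b (suc c) false b+c≡ ε′ |ε′| = begin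
      Eprod a * Rows a L (prefixPlus a (rowOut a b (suc c) false)) ε′
        ≡⟨ cong (Eprod a *_) (Rows-prefixPlus-scaled a L (B a b (suc c)) _ (C (suc b) c) (λ δ _ → refl) ε′ |ε′|) ⟩
      Eprod a * (B a b (suc c) * Rows a L (prefixPlus a (C (suc b) c)) ε′)
        ≡⟨ x∙yz≡y∙xz (Eprod a) (B a b (suc c)) _ ⟩
      B a b (suc c) * (Eprod a * Rows a L (prefixPlus a (C (suc b) c)) ε′)
        ≡⟨ cong (B a b (suc c) *_) (rows-a L (suc b) c (trans (sym (ℕ.+-suc b c)) b+c≡) ε′ |ε′|) ⟩
      B a b (suc c) * (rowsCoeff a (suc b) c * C (a ℕ.+ suc b) c ε′)
        ≡⟨ cong (λ n → B a b (suc c) * (rowsCoeff a (suc b) c * C n c ε′)) (ℕ.+-suc a b) ⟩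
      B a b (suc c) * (rowsCoeff a (suc b) c * C (suc a ℕ.+ b) c ε′)
        ≡⟨ ℚ.*-assoc (B a b (suc c)) _ _ ⟨
      (B a b (suc c) * rowsCoeff a (suc b) c) * C (suc a ℕ.+ b) c ε′
        ≡⟨ cong (_* C (suc a ℕ.+ b) c ε′) (rowsCoeff-step a b c) ⟩
      (rowsCoeff (suc a) b (suc c) * (- q) ^ suc (a ℕ.+ b)) * C (suc a ℕ.+ b) c ε′
        ≡⟨ ℚ.*-assoc (rowsCoeff (suc a) b (suc c)) _ _ ⟩
      rowsCoeff (suc a) b (suc c) * ((- q) ^ suc (a ℕ.+ b) * C (suc a ℕ.+ b) c ε′)
        ≡⟨ cong (rowsCoeff (suc a) b (suc c) *_) (C-∣last-⁻ (suc a ℕ.+ b) c ε′) ⟨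
      rowsCoeff (suc a) b (suc c) * C (suc a ℕ.+ b) (suc c) (ε′ ++ false ∷ []) ∎

    rows : ∀ a → RowsLemma a
    rows zero    L b c _    ε _   = refl
    rows (suc a) L b c b+c≡ ε |ε| with snoc-view ε (a ℕ.+ L) |ε|
    ... | ε′ , w , refl , |ε′| =
      trans (rows-peel a L b c w b+c≡ ε′ |ε′|) (rows-lastLetter a (rows a) L b c w b+c≡ ε′ |ε′|)

    Rows-one : ∀ k m ε → length ε ≡ k ℕ.+ m → Rows k m (prefixPlus k (C 0 m)) ε ≡ (q ^ m) ^ k * C k m ε
    Rows-one k m ε |ε| = *-cancelˡ (Eprod-≢0 k) (begin
      Eprod k * Rows k m (prefixPlus k (C 0 m)) ε   ≡⟨ rows k m 0 m refl ε |ε| ⟩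
      rowsCoeff k 0 m * C (k ℕ.+ 0) m ε             ≡⟨ cong₂ (λ x n → x * C n m ε) (rowsCoeff-0 k m) (ℕ.+-identityʳ k) ⟩
      (q ^ m) ^ k * Eprod k * C k m ε               ≡⟨ ring ((q ^ m) ^ k) (Eprod k) (C k m ε) ⟩
      Eprod k * ((q ^ m) ^ k * C k m ε)             ∎)
      where
      ring : ∀ x d c → x * d * c ≡ d * (x * c)
      ring = solve-∀ ℚ-ring

    -- The factors T_i - v^r/[r] and the bar involution

    factor : ℕ → ℕ → H
    factor i r = T i ⊕ sc (-F ratio r)

    DefinedH-factor : ∀ i r → DefinedH (factor i (suc r))
    DefinedH-factor i r = tt , subst (_≢ 0ℚ) (sym (denAt-negF (ratio (suc r)) q)) (ratio-den≢0 r)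

    q*factor : ∀ i r g ε → q * coeffH (factor i r) g ε ≡ F i r g ε
    q*factor i r g ε = begin
      q * (coeffT i g ε + evalF q (-F ratio r) * g ε)     ≡⟨ cong (λ x → q * (coeffT i g ε + x * g ε)) (evalF-negF q (ratio r)) ⟩
      q * (coeffT i g ε + - evalF q (ratio r) * g ε)      ≡⟨ ring q (coeffT i g ε) (evalF q (ratio r)) (g ε) ⟩
      q * coeffT i g ε - κ r * g ε                        ∎
      where
      ring : ∀ q t s x → q * (t + - s * x) ≡ q * t - (q * s) * x
      ring = solve-∀ ℚ-ring

    ratio-den≢0-at-p : ∀ r → denAt (ratio (suc r)) p ≢ 0ℚ
    ratio-den≢0-at-p r = subst (_≢ 0ℚ) (sym (denAt-ratio (suc r) p)) (*-≢0 ww-1≢0 p≢0)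
      where
      u = q ^ suc r
      w = p ^ suc r
      ring₁ : ∀ u → - (u * u - 1ℚ) ≡ 1ℚ * 1ℚ - u * u
      ring₁ = solve-∀ ℚ-ring
      ring₂ : ∀ u w → (u * w) * (u * w) - u * u ≡ (w * w - 1ℚ) * (u * u)
      ring₂ = solve-∀ ℚ-ring
      ww-1≢0 : w * w - 1ℚ ≢ 0ℚ
      ww-1≢0 eq = neg-≢0 (E≢0 r) (begin
        - E (suc r)                            ≡⟨ ring₁ u ⟩
        1ℚ * 1ℚ - u * u                        ≡⟨ cong (λ x → x * x - u * u) (inv-^ (suc r) q≢0) ⟨
        (u * w) * (u * w) - u * u              ≡⟨ ring₂ u w ⟩
        (w * w - 1ℚ) * (u * u)                 ≡⟨ cong (_* (u * u)) eq ⟩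
        0ℚ * (u * u)                           ≡⟨ ℚ.*-zeroˡ (u * u) ⟩
        0ℚ                                     ∎)

    ratio-at-inverse : ∀ r → evalF p (ratio (suc r)) * (E (suc r) * q) ≡ q * q - 1ℚ
    ratio-at-inverse r = ℚ.neg-injective (begin
      - (s′ * (E r′ * q))                                            ≡⟨ ring₁ s′ u q ⟩
      s′ * (1ℚ * 1ℚ * q - u * u * 1ℚ * q)                            ≡⟨ cong₂ (λ x y → s′ * (x * x * y * q - u * u * y * q)) uw≡1 qp≡1 ⟨
      s′ * ((u * w) * (u * w) * (q * p) * q - u * u * (q * p) * q)   ≡⟨ ring₂ s′ u w q p ⟩
      u * u * q * q * (s′ * ((w * w - 1ℚ) * p))                      ≡⟨ cong (u * u * q * q *_) (ratio-value r′ (ratio-den≢0-at-p r)) ⟩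
      u * u * q * q * (w * (w * (p * p - 1ℚ)))                       ≡⟨ ring₃ u w q p ⟩
      (u * w) * (u * w) * (q * p) * (q * p) - (u * w) * (u * w) * q * q
                                                                     ≡⟨ cong₂ (λ x y → x * x * y * y - x * x * q * q) uw≡1 qp≡1 ⟩
      1ℚ * 1ℚ * 1ℚ * 1ℚ - 1ℚ * 1ℚ * q * q                            ≡⟨ ring₄ q ⟩
      - (q * q - 1ℚ)                                                 ∎)
      where
      r′ = suc r
      u = q ^ r′
      w = p ^ r′
      s′ = evalF p (ratio r′)
      uw≡1 : u * w ≡ 1ℚ
      uw≡1 = inv-^ r′ q≢0
      ring₁ : ∀ s u q → - (s * ((u * u - 1ℚ) * q)) ≡ s * (1ℚ * 1ℚ * q - u * u * 1ℚ * q)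
      ring₁ = solve-∀ ℚ-ring
      ring₂ : ∀ s u w q p → s * ((u * w) * (u * w) * (q * p) * q - u * u * (q * p) * q) ≡ u * u * q * q * (s * ((w * w - 1ℚ) * p))
      ring₂ = solve-∀ ℚ-ring
      ring₃ : ∀ u w q p → u * u * q * q * (w * (w * (p * p - 1ℚ))) ≡ (u * w) * (u * w) * (q * p) * (q * p) - (u * w) * (u * w) * q * q
      ring₃ = solve-∀ ℚ-ring
      ring₄ : ∀ q → 1ℚ * 1ℚ * 1ℚ * 1ℚ - 1ℚ * 1ℚ * q * q ≡ - (q * q - 1ℚ)
      ring₄ = solve-∀ ℚ-ring

    -- v^r/[r] - v^(-r)/[r] = v - v⁻¹, so that each factor of X_λ is bar invariant.
    ratio-bar-difference : ∀ r → evalF q (ratio (suc r)) ≡ (q - p) + evalF p (ratio (suc r))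
    ratio-bar-difference r = trans (ring₀ s s′) (cong (_+ s′) (*-cancelʳ {a = s - s′} {b = q - p} (*-≢0 (E≢0 r) q≢0) (begin
      (s - s′) * (E r′ * q)              ≡⟨ ring₁ s s′ (E r′) q ⟩
      E r′ * (q * s) - s′ * (E r′ * q)   ≡⟨ cong₂ _-_ (E*κ≡N r) (ratio-at-inverse r) ⟩
      N r′ - (q * q - 1ℚ)                ≡⟨ ring₂ q (q ^ r′) ⟩
      E r′ * (q * q - 1ℚ)                ≡⟨ cong (λ x → E r′ * (q * q - x)) qp≡1 ⟨
      E r′ * (q * q - q * p)             ≡⟨ ring₃ (E r′) q p ⟩
      (q - p) * (E r′ * q)               ∎)))
      where
      r′ = suc r
      s = evalF q (ratio r′)
      s′ = evalF p (ratio r′)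
      ring₀ : ∀ s s′ → s ≡ (s - s′) + s′
      ring₀ = solve-∀ ℚ-ring
      ring₁ : ∀ s s′ e q → (s - s′) * (e * q) ≡ e * (q * s) - s′ * (e * q)
      ring₁ = solve-∀ ℚ-ring
      ring₂ : ∀ q u → u * u * (q * q - 1ℚ) - (q * q - 1ℚ) ≡ (u * u - 1ℚ) * (q * q - 1ℚ)
      ring₂ = solve-∀ ℚ-ring
      ring₃ : ∀ e q p → e * (q * q - q * p) ≡ (q - p) * (e * q)
      ring₃ = solve-∀ ℚ-ring

    barF-factor↦ : ∀ r → barF (-F ratio (suc r)) ↦[ q ] - evalF p (ratio (suc r))
    barF-factor↦ r = ↦-barF q≢0 (↦-negF (↦-evalF (ratio (suc r)) (ratio-den≢0-at-p r)))

    DefinedH-barH-factor : ∀ i r → DefinedH (barH (factor i (suc r)))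
    DefinedH-barH-factor i r = tt , _↦[_]_.den≢0 (barF-factor↦ r)

    factor-barInvariant : ∀ i r → BarInvariant (factor i (suc r))
    factor-barInvariant i r g ε = begin
      (coeffT i g ε - (q - p) * g ε) + evalF q (barF (-F ratio r′)) * g ε
        ≡⟨ cong (λ x → (coeffT i g ε - (q - p) * g ε) + x * g ε) (↦⇒evalF≡ (barF-factor↦ r)) ⟩
      (coeffT i g ε - (q - p) * g ε) + - evalF p (ratio r′) * g ε
        ≡⟨ ring (coeffT i g ε) (q - p) (evalF p (ratio r′)) (g ε) ⟩
      coeffT i g ε + - ((q - p) + evalF p (ratio r′)) * g ε
        ≡⟨ cong (λ x → coeffT i g ε + - x * g ε) (ratio-bar-difference r) ⟨
      coeffT i g ε + - evalF q (ratio r′) * g ε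
        ≡⟨ cong (λ x → coeffT i g ε + x * g ε) (evalF-negF q (ratio r′)) ⟨
      coeffT i g ε + evalF q (-F ratio r′) * g ε ∎
      where
      r′ = suc r
      ring : ∀ t d s x → (t - d * x) + - s * x ≡ t + - (d + s) * x
      ring = solve-∀ ℚ-ring

    module RectangleAt (k m : ℕ) where
      open Rectangle k m

      Yfac-factor : ∀ i j → 1 ≤ i → i ≤ k → suc j ≤ m →
                    Yfac k lam i (suc j) ≡ factor (suc ((k ∸ i) ℕ.+ j)) (suc ((k ∸ i) ℕ.+ (m ∸ suc j)))
      Yfac-factor i j 1≤i i≤k j<m =
        cong₂ (λ a r → T a ⊕ sc (-F ratio r)) (index-inside i j i≤k) (shift-inside i (suc j) 1≤i i≤k (s≤s z≤n) j<m)

      Yfac-property : ∀ (P : H → Set) → (∀ i r → P (factor i (suc r))) →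
                      ∀ i → 1 ≤ i → i ≤ k → ∀ j → suc j ≤ m → P (Yfac k lam i (suc j))
      Yfac-property P Pfactor i 1≤i i≤k j j<m =
        subst P (sym (Yfac-factor i j 1≤i i≤k j<m)) (Pfactor (suc ((k ∸ i) ℕ.+ j)) ((k ∸ i) ℕ.+ (m ∸ suc j)))

      Y-property : ∀ (P : H → Set) → P (sc 1F) → (∀ h h' → P h → P h' → P (h ⊗ h')) → (∀ i r → P (factor i (suc r))) →
                   ∀ i → 1 ≤ i → i ≤ k → P (Y k lam i)
      Y-property P P1 P⊗ Pfactor i 1≤i i≤k =
        prodH-downFrom P P1 P⊗ (Yfac k lam i) (row lam i)
          (λ j j<row → Yfac-property P Pfactor i 1≤i i≤k j (subst (suc j ≤_) (row-inside i 1≤i i≤k) j<row))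

      X-property : ∀ (P : H → Set) → P (sc 1F) → (∀ h h' → P h → P h' → P (h ⊗ h')) → (∀ i r → P (factor i (suc r))) →
                   P (X k lam)
      X-property P P1 P⊗ Pfactor =
        prodH-downFrom P P1 P⊗ (Y k lam) (length lam)
          (λ i i<k → Y-property P P1 P⊗ Pfactor (suc i) (s≤s z≤n) (subst (suc i ≤_) (List.length-replicate k) i<k))

      Y-row : ∀ i → 1 ≤ i → i ≤ k → ∀ j → j ≤ m → ∀ g ε →
              q ^ j * coeffH (prodH (map (Yfac k lam i) (downFrom j))) g ε ≡ Row (k ∸ i) ((k ∸ i) ℕ.+ (m ∸ j)) j g ε
      Y-row i 1≤i i≤k zero    _   g ε = trans (ℚ.*-identityˡ _) (trans (cong (_* g ε) (↦⇒evalF≡ 1F↦1)) (ℚ.*-identityˡ (g ε)))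
      Y-row i 1≤i i≤k (suc j) j<m g ε = begin
        q * q ^ j * coeffH (Yfac k lam i (suc j)) G ε
          ≡⟨ ring q (q ^ j) _ ⟩
        q ^ j * (q * coeffH (Yfac k lam i (suc j)) G ε)
          ≡⟨ cong (λ h → q ^ j * (q * coeffH h G ε)) (Yfac-factor i j 1≤i i≤k j<m) ⟩
        q ^ j * (q * coeffH (factor (suc (s ℕ.+ j)) (suc K)) G ε)
          ≡⟨ cong (q ^ j *_) (q*factor (suc (s ℕ.+ j)) (suc K) G ε) ⟩
        q ^ j * F (suc (s ℕ.+ j)) (suc K) G ε
          ≡⟨ F-homogeneous (suc (s ℕ.+ j)) (suc K) (q ^ j) G ε ⟨
        F (suc (s ℕ.+ j)) (suc K) (λ δ → q ^ j * G δ) ε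
          ≡⟨ F-local (suc (s ℕ.+ j)) (suc K) (λ δ _ → Y-row i 1≤i i≤k j (ℕ.<⇒≤ j<m) g δ) ε refl ⟩
        F (suc (s ℕ.+ j)) (suc K) (Row s (s ℕ.+ (m ∸ j)) j g) ε
          ≡⟨ cong (λ K′ → F (suc (s ℕ.+ j)) (suc K) (Row s K′ j g) ε) shift-step ⟨
        Row s K (suc j) g ε ∎
        where
        s = k ∸ i
        K = s ℕ.+ (m ∸ suc j)
        G = coeffH (prodH (map (Yfac k lam i) (downFrom j))) g
        shift-step : suc K ≡ s ℕ.+ (m ∸ j)
        shift-step = trans (sym (ℕ.+-suc s (m ∸ suc j))) (cong (s ℕ.+_) (suc-∸-suc j<m))
        ring : ∀ q y x → q * y * x ≡ y * (q * x)
        ring = solve-∀ ℚ-ring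

      X-rows : ∀ a → a ≤ k → ∀ g ε → (q ^ m) ^ a * coeffH (prodH (map (Y k lam) (downFrom a))) g ε ≡ RowsFrom (k ∸ a) a m g ε
      X-rows zero    _   g ε = trans (ℚ.*-identityˡ _) (trans (cong (_* g ε) (↦⇒evalF≡ 1F↦1)) (ℚ.*-identityˡ (g ε)))
      X-rows (suc a) a<k g ε = begin
        q ^ m * (q ^ m) ^ a * coeffH (Y k lam (suc a)) G ε
          ≡⟨ ring (q ^ m) ((q ^ m) ^ a) _ ⟩
        (q ^ m) ^ a * (q ^ m * coeffH (Y k lam (suc a)) G ε)
          ≡⟨ cong (λ j → (q ^ m) ^ a * (q ^ m * coeffH (prodH (map (Yfac k lam (suc a)) (downFrom j))) G ε)) (row-inside (suc a) (s≤s z≤n) a<k) ⟩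
        (q ^ m) ^ a * (q ^ m * coeffH (prodH (map (Yfac k lam (suc a)) (downFrom m))) G ε)
          ≡⟨ cong ((q ^ m) ^ a *_) (Y-row (suc a) (s≤s z≤n) a<k m ℕ.≤-refl G ε) ⟩
        (q ^ m) ^ a * Row s (s ℕ.+ (m ∸ m)) m G ε
          ≡⟨ cong (λ K → (q ^ m) ^ a * Row s K m G ε) (trans (cong (s ℕ.+_) (ℕ.n∸n≡0 m)) (ℕ.+-identityʳ s)) ⟩
        (q ^ m) ^ a * Row s s m G ε
          ≡⟨ Row-homogeneous s s m ((q ^ m) ^ a) G ε ⟨
        Row s s m (λ δ → (q ^ m) ^ a * G δ) ε
          ≡⟨ Row-local s s m (λ δ _ → X-rows a (ℕ.<⇒≤ a<k) g δ) ε refl ⟩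
        Row s s m (RowsFrom (k ∸ a) a m g) ε
          ≡⟨ cong (λ t → Row s s m (RowsFrom t a m g) ε) (suc-∸-suc a<k) ⟨
        Row s s m (RowsFrom (suc s) a m g) ε
          ≡⟨ RowsFrom-suc s a m g ε ⟨
        RowsFrom s (suc a) m g ε ∎
        where
        s = k ∸ suc a
        G = coeffH (prodH (map (Y k lam) (downFrom a))) g
        ring : ∀ y x z → y * x * z ≡ x * (y * z)
        ring = solve-∀ ℚ-ring

      X-coeffs : ∀ g ε → (q ^ m) ^ k * coeffH (X k lam) g ε ≡ Rows k m g ε
      X-coeffs g ε = begin
        (q ^ m) ^ k * coeffH (prodH (map (Y k lam) (downFrom (length lam)))) g ε
          ≡⟨ cong (λ a → (q ^ m) ^ k * coeffH (prodH (map (Y k lam) (downFrom a))) g ε) (List.length-replicate k) ⟩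
        (q ^ m) ^ k * coeffH (prodH (map (Y k lam) (downFrom k))) g ε
          ≡⟨ X-rows k ℕ.≤-refl g ε ⟩
        RowsFrom (k ∸ k) k m g ε
          ≡⟨ cong (λ t → RowsFrom t k m g ε) (ℕ.n∸n≡0 k) ⟩
        Rows k m g ε ∎

    module _ (n k : ℕ) (k≤n : k ≤ n) where
      m : ℕ
      m = n ∸ k

      open RectangleAt k m

      𝟏 : M
      𝟏 = basis (one n k)

      Defined-𝟏 : Defined 𝟏
      Defined-𝟏 = 1F-defined ∷ []

      coeffsAt-𝟏 : ∀ ε → coeffsAt 𝟏 ε ≡ prefixPlus k (C 0 m) ε
      coeffsAt-𝟏 ε = begin
        coeffsAt 𝟏 ε                                           ≡⟨ coeffsAt-basis (one n k) ε ⟩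
        single (replicate k true ++ replicate m false) 1ℚ ε    ≡⟨ single-pluses k (replicate m false) 1ℚ ε ⟩
        prefixPlus k (single (replicate m false) 1ℚ) ε          ≡⟨ prefixPlus-≗ k (single-minuses m) ε ⟩
        prefixPlus k (C 0 m) ε                                 ∎

      Xλ : H
      Xλ = X k (rect n k)

      X-𝟏 : ∀ ε → length ε ≡ k ℕ.+ m → coeffH Xλ (coeffsAt 𝟏) ε ≡ C k m ε
      X-𝟏 ε |ε| = *-cancelˡ (^-≢0 k (^-≢0 m q≢0)) (begin
        (q ^ m) ^ k * coeffH Xλ (coeffsAt 𝟏) ε        ≡⟨ X-coeffs (coeffsAt 𝟏) ε ⟩
        Rows k m (coeffsAt 𝟏) ε                       ≡⟨ RowsFrom-local 0 k m (λ δ _ → coeffsAt-𝟏 δ) ε refl ⟩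
        Rows k m (prefixPlus k (C 0 m)) ε             ≡⟨ Rows-one k m ε |ε| ⟩
        (q ^ m) ^ k * C k m ε                         ∎)

      X𝟏 barX𝟏 : M
      X𝟏 = actH Xλ 𝟏
      barX𝟏 = actH (barH Xλ) 𝟏

      X𝟏-defined : Defined X𝟏 × (∀ ε → coeffsAt X𝟏 ε ≡ coeffH Xλ (coeffsAt 𝟏) ε)
      X𝟏-defined = actH-coeffsAt Xλ 𝟏 (X-property DefinedH 1F-defined DefinedH-⊗ DefinedH-factor) Defined-𝟏

      barX𝟏-defined : Defined barX𝟏 × (∀ ε → coeffsAt barX𝟏 ε ≡ coeffH (barH Xλ) (coeffsAt 𝟏) ε)
      barX𝟏-defined = actH-coeffsAt (barH Xλ) 𝟏
        (X-property (DefinedH ∘ barH) 1F-defined (λ h h' → DefinedH-⊗ (barH h) (barH h')) DefinedH-barH-factor) Defined-𝟏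

      |ε|≡k+m : ∀ ε → InE n k ε → length ε ≡ k ℕ.+ m
      |ε|≡k+m ε (|ε| , _) = trans |ε| (sym (ℕ.m+[n∸m]≡n k≤n))

      countMinus≡m : ∀ ε → InE n k ε → countMinus ε ≡ m
      countMinus≡m ε (|ε| , #+≡k) = begin
        countMinus ε                               ≡⟨ ℕ.m+n∸m≡n k (countMinus ε) ⟨
        (k ℕ.+ countMinus ε) ∸ k                   ≡⟨ cong (λ x → (x ℕ.+ countMinus ε) ∸ k) #+≡k ⟨
        (countPlus ε ℕ.+ countMinus ε) ∸ k         ≡⟨ cong (_∸ k) (trans (sym (length≡countPlus+countMinus ε)) |ε|) ⟩
        m                                          ∎

      X𝟏-value : ∀ ε → InE n k ε → coeffsAt X𝟏 ε ≡ (- q) ^ coinv ε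
      X𝟏-value ε ε∈E = begin
        coeffsAt X𝟏 ε                            ≡⟨ proj₂ X𝟏-defined ε ⟩
        coeffH Xλ (coeffsAt 𝟏) ε                 ≡⟨ X-𝟏 ε (|ε|≡k+m ε ε∈E) ⟩
        C k m ε                                  ≡⟨ cong₂ (λ b c → C b c ε) (sym (proj₂ ε∈E)) (sym (countMinus≡m ε ε∈E)) ⟩
        C (countPlus ε) (countMinus ε) ε         ≡⟨ C-coinv ε ⟩
        (- q) ^ coinv ε                          ∎

      X𝟏↦ : ∀ ε → InE n k ε → coeffM X𝟏 ε ↦[ q ] (- q) ^ coinv ε
      X𝟏↦ ε ε∈E = subst (coeffM X𝟏 ε ↦[ q ]_) (X𝟏-value ε ε∈E) (coeffM-↦ X𝟏 ε (proj₁ X𝟏-defined))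

      barX𝟏↦ : ∀ ε → InE n k ε → coeffM barX𝟏 ε ↦[ q ] (- q) ^ coinv ε
      barX𝟏↦ ε ε∈E = subst (coeffM barX𝟏 ε ↦[ q ]_) value (coeffM-↦ barX𝟏 ε (proj₁ barX𝟏-defined))
        where
        value : coeffsAt barX𝟏 ε ≡ (- q) ^ coinv ε
        value = begin
          coeffsAt barX𝟏 ε                         ≡⟨ proj₂ barX𝟏-defined ε ⟩
          coeffH (barH Xλ) (coeffsAt 𝟏) ε          ≡⟨ X-property BarInvariant (λ g ε → refl) BarInvariant-⊗ factor-barInvariant (coeffsAt 𝟏) ε ⟩
          coeffH Xλ (coeffsAt 𝟏) ε                 ≡⟨ proj₂ X𝟏-defined ε ⟨
          coeffsAt X𝟏 ε                            ≡⟨ X𝟏-value ε ε∈E ⟩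
          (- q) ^ coinv ε                          ∎

      w : Seq
      w = wact (wword k (rect n k)) (one n k)

      w≡sorted : w ≡ replicate m false ++ replicate k true
      w≡sorted = RectangleWord.wact-rectangle k m

      difference↦ : ∀ ε → InE n k ε → coeffM (X𝟏 -M basis w) ε ↦[ q ] reducedPower (coinv ε)
      difference↦ ε ε∈E = subst (coeffM (X𝟏 -M basis w) ε ↦[ q ]_) value (coeffM-↦ (X𝟏 -M basis w) ε X𝟏-w-defined)
        where
        -1≢0 : denAt (-F 1F) q ≢ 0ℚ
        -1≢0 = _↦[_]_.den≢0 -1F↦-1
        X𝟏-w-defined : Defined (X𝟏 -M basis w)
        X𝟏-w-defined = Defined-++ (proj₁ X𝟏-defined) (Defined-*sM (-F 1F) (basis w) -1≢0 (1F-defined ∷ []))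
        ε≡w : coinv ε ≡ 0 → ε ≡ w
        ε≡w coinv≡0 = trans (coinv≡0⇒sorted ε coinv≡0)
          (trans (cong₂ (λ a b → replicate a false ++ replicate b true) (countMinus≡m ε ε∈E) (proj₂ ε∈E)) (sym w≡sorted))
        by-coinv : ∀ c → coinv ε ≡ c → (- q) ^ c + - 1ℚ * single w 1ℚ ε ≡ reducedPower c
        by-coinv zero    coinv≡0 = begin
          1ℚ + - 1ℚ * single w 1ℚ ε      ≡⟨ cong (λ x → 1ℚ + - 1ℚ * single w 1ℚ x) (ε≡w coinv≡0) ⟩
          1ℚ + - 1ℚ * single w 1ℚ w      ≡⟨ cong (λ x → 1ℚ + - 1ℚ * x) (single-refl w 1ℚ) ⟩
          0ℚ                             ∎
        by-coinv (suc c) coinv≡1+c = begin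
          (- q) ^ suc c + - 1ℚ * single w 1ℚ ε   ≡⟨ cong (λ x → (- q) ^ suc c + - 1ℚ * x) (single-≢ w 1ℚ ε w≢ε) ⟩
          (- q) ^ suc c + - 1ℚ * 0ℚ              ≡⟨ a+d*0≡a _ (- 1ℚ) ⟩
          (- q) ^ suc c                          ∎
          where
          w≢ε : w ≢ ε
          w≢ε w≡ε = ℕ.0≢1+n (trans (sym (coinv-sorted m k)) (trans (cong coinv (trans (sym w≡sorted) w≡ε)) coinv≡1+c))
        value : coeffsAt (X𝟏 -M basis w) ε ≡ reducedPower (coinv ε)
        value = begin
          coeffsAt (X𝟏 ++ (-F 1F) *sM basis w) ε
            ≡⟨ coeffsAt-++ X𝟏 _ ε ⟩
          coeffsAt X𝟏 ε + coeffsAt ((-F 1F) *sM basis w) ε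
            ≡⟨ cong₂ _+_ (X𝟏-value ε ε∈E) (coeffsAt-*sM (-F 1F) (basis w) ε -1≢0 (1F-defined ∷ [])) ⟩
          (- q) ^ coinv ε + evalF q (-F 1F) * coeffsAt (basis w) ε
            ≡⟨ cong₂ (λ a b → (- q) ^ coinv ε + a * b) (↦⇒evalF≡ -1F↦-1) (coeffsAt-basis w ε) ⟩
          (- q) ^ coinv ε + - 1ℚ * single w 1ℚ ε
            ≡⟨ by-coinv (coinv ε) refl ⟩
          reducedPower (coinv ε) ∎

point≢0 : ∀ t → point t ≢ 0ℚ
point≢0 t = ℚ.<⇒≢ (0<ι-suc (suc t)) ∘ sym

point-nondegenerate : ∀ t r → AtPoint.E (point t) (point≢0 t) (suc r) ≢ 0ℚ
point-nondegenerate t r E≡0 = N²≢1 (ι-injective (begin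
  ι (N ℕ.* N)                    ≡⟨ ι-* N N ⟩
  ι N * ι N                      ≡⟨ cong₂ _*_ (ι-^ (2 ℕ.+ t) (suc r)) (ι-^ (2 ℕ.+ t) (suc r)) ⟩
  q ^ suc r * q ^ suc r          ≡⟨ x-y≡0⇒x≡y E≡0 ⟩
  1ℚ                             ∎))
  where
  open ≡-Reasoning
  q = point t
  N = (2 ℕ.+ t) ℕ.^ suc r
  N²≢1 : N ℕ.* N ≢ 1
  N²≢1 N²≡1 with ℕ.m^n≡1⇒n≡0∨m≡1 (2 ℕ.+ t) (suc r) (ℕ.m*n≡1⇒m≡1 N N N²≡1)
  ... | inj₁ ()
  ... | inj₂ ()

proposition2p2 : (n k : ℕ) → 1 ≤ k → k < n →
    (wact (wword k (rect n k)) (one n k) ≡ replicate (n ∸ k) false ++ replicate k true)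
    × (∀ ε → InE n k ε →
        coeffM (actH (X k (rect n k)) (basis (one n k))) ε
          ≈F coeffM (actH (barH (X k (rect n k))) (basis (one n k))) ε)
    × (∀ ε → InE n k ε →
        InVZv (coeffM (actH (X k (rect n k)) (basis (one n k))
                       -M basis (wact (wword k (rect n k)) (one n k))) ε))
proposition2p2 n k _ k<n = RectangleWord.wact-rectangle k (n ∸ k) , bar-invariant , unitriangular
  where
  module At (t : ℕ) = AtPoint.Nondegenerate (point t) (point≢0 t) (point-nondegenerate t)

  k≤n : k ≤ n
  k≤n = ℕ.<⇒≤ k<n

  X𝟏 : M
  X𝟏 = actH (X k (rect n k)) (basis (one n k))

  bar-invariant : ∀ ε → InE n k ε → coeffM X𝟏 ε ≈F coeffM (actH (barH (X k (rect n k))) (basis (one n k))) ε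
  bar-invariant ε ε∈E = ≈F-byEvaluation _ _ (λ t → (- point t) ^ coinv ε)
    (λ t → At.X𝟏↦ t n k k≤n ε ε∈E) (λ t → At.barX𝟏↦ t n k k≤n ε ε∈E)

  unitriangular : ∀ ε → InE n k ε → InVZv (coeffM (X𝟏 -M basis (wact (wword k (rect n k)) (one n k))) ε)
  unitriangular ε ε∈E = shiftedPower (coinv ε) ,
    ≈F-byEvaluation _ _ (λ t → AtPoint.reducedPower (point t) (point≢0 t) (coinv ε))
      (λ t → At.difference↦ t n k k≤n ε ε∈E) (λ t → AtPoint.shiftedPower↦ (point t) (point≢0 t) (coinv ε))
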